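{- Let $p$ be a prime, let $S$ be a finite commutative semigroup such that $\exp(S)$ is a power of $p$, and let $R$ be a commutative unitary ring of characteristic $p$. Then: (i) If $T=s_1\cdots s_\ell$ is a sequence over $S$ with $\ell\ge\Lambda(S)$, then $\prod_{i=1}^\ell(X^{s_i}-X^{e(s_i)})=0$ in $R[X;S]$, and moreover ${\rm St}(e)\cap\Sigma(T)\ne\emptyset$, where $e=\sum_{i=1}^\ell e(s_i)$; (ii) $d(S,R)\le\Lambda(S)-1$.
   Context: Semigroups are commutative, written additively; $\langle x\rangle=\{mx:m\ge1\}$; $e(x)$ is the unique idempotent in $\langle x\rangle$ and $\rho(x)$ is the least positive integer $m$ with $mx=e(x)$. The period of $x$ is the least $n>0$ with $(k+n)x=kx$, $k$ being the index of $x$; $\exp(S)$ is the lcm of all periods. $\Lambda(S)=\min_A\{1+\sum_{a\in A}(\rho(a)-1)\}$, where $A$ ranges over all generating sets of $S$. $R[X;S]$ is the semigroup ring with basis $\{X^s\}$ and $X^sX^t=X^{s+t}$. For $e\in S$, ${\rm St}(e)=\{c\in S:c+e=e\}$. For a sequence $T$ over $S$, $\Sigma(T)$ is the set of sums of nonempty subsequences of $T$. $d(S,R)$ is the supremum of all $\ell$ such that some sequence $s_1\cdots s_\ell$ over $S$ satisfies $\prod_i(X^{s_i}-a_iX^{e(s_i)})\ne0$ for all $a_1,\dots,a_\ell\in R\setminus\{0\}$. -}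

module Defs where

open import Level using (Level)
open import Data.Nat using (ℕ; zero; suc; _≤_; _<_; _∸_)
open import Data.Nat as ℕ using ()
open import Data.Nat.LCM using (lcm)
open import Data.Bool using (Bool; true; false)
open import Data.List using (List; []; _∷_; map; foldr; zipWith; length)
open import Data.Nat.ListAction using (sum)
open import Data.List.Membership.Propositional using (_∈_)
open import Data.List.Relation.Unary.Unique.Propositional using (Unique)
open import Data.List.Relation.Binary.Sublist.Propositional using (_⊆_)
open import Data.Maybe using (Maybe; just; nothing)
open import Data.Product using (Σ; ∃; _×_; _,_)
open import Relation.Nullary using (¬_; yes; no)
open import Relation.Binary.Definitions using (DecidableEquality)
open import Relation.Binary.PropositionalEquality using (_≡_)
open import Algebra.Bundles using (CommutativeRing)

record FinCommSemigroup : Set₁ where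
  infixl 6 _⊕_
  field
    Carrier   : Set
    _≟_       : DecidableEquality Carrier
    _⊕_       : Carrier → Carrier → Carrier
    assoc     : ∀ x y z → (x ⊕ y) ⊕ z ≡ x ⊕ (y ⊕ z)
    comm      : ∀ x y → x ⊕ y ≡ y ⊕ x
    elements  : List Carrier
    elems-unique   : Unique elements
    elems-complete : ∀ x → x ∈ elements

module SemigroupNotions (S : FinCommSemigroup) where
  open FinCommSemigroup S

  -- m · x  =  x + x + ... + x  (m copies), meaningful for m ≥ 1.
  -- (The value at m = 0 is junk and is never used: every use carries 1 ≤ m.)
  _·_ : ℕ → Carrier → Carrier
  zero · x = x
  suc zero · x = x
  suc (suc m) · x = x ⊕ (suc m · x)

  IsIdempotent : Carrier → Set
  IsIdempotent y = y ⊕ y ≡ y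

  InCyclic : Carrier → Carrier → Set
  InCyclic x y = Σ ℕ λ m → 1 ≤ m × m · x ≡ y

  Returns : Carrier → ℕ → Set
  Returns x k = Σ ℕ λ n → 1 ≤ n × (k ℕ.+ n) · x ≡ k · x

  IsIndex : Carrier → ℕ → Set
  IsIndex x k = 1 ≤ k × Returns x k × (∀ j → 1 ≤ j → j < k → ¬ Returns x j)

  IsPeriod : Carrier → ℕ → Set
  IsPeriod x n = Σ ℕ λ k → IsIndex x k × 1 ≤ n × (k ℕ.+ n) · x ≡ k · x
                 × (∀ m → 1 ≤ m → m < n → ¬ ((k ℕ.+ m) · x ≡ k · x))

  -- The cyclic-subsemigroup data of S: e(x), ρ(x) and the period of x,
  -- each characterised exactly as in the paper (they exist and are unique
  -- in a finite semigroup, so quantifying over such data is faithful).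
  record CyclicData : Set where
    field
      e        : Carrier → Carrier
      e-in     : ∀ x → InCyclic x (e x)
      e-idem   : ∀ x → IsIdempotent (e x)
      e-unique : ∀ x y → InCyclic x y → IsIdempotent y → y ≡ e x
      ρ        : Carrier → ℕ
      ρ-pos    : ∀ x → 1 ≤ ρ x
      ρ-spec   : ∀ x → ρ x · x ≡ e x
      ρ-least  : ∀ x m → 1 ≤ m → m < ρ x → ¬ (m · x ≡ e x)
      period   : Carrier → ℕ
      period-spec : ∀ x → IsPeriod x (period x)

  module WithData (D : CyclicData) where
    open CyclicData D

    expS : ℕ
    expS = foldr (λ x r → lcm (period x) r) 1 elements

    data Generated (A : List Carrier) : Carrier → Set where
      gen-base : ∀ {a} → a ∈ A → Generated A a
      gen-add  : ∀ {x y} → Generated A x → Generated A y → Generated A (x ⊕ y)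

    GeneratingSet : List Carrier → Set
    GeneratingSet A = Unique A × (∀ s → Generated A s)

    cost : List Carrier → ℕ
    cost A = 1 ℕ.+ sum (map (λ a → ρ a ∸ 1) A)

    IsLambda : ℕ → Set
    IsLambda L = (Σ (List Carrier) λ A → GeneratingSet A × cost A ≡ L)
               × (∀ A → GeneratingSet A → L ≤ cost A)

    sumS : List Carrier → Maybe Carrier
    sumS [] = nothing
    sumS (x ∷ xs) with sumS xs
    ... | nothing = just x
    ... | just y  = just (x ⊕ y)

    InΣ : List Carrier → Carrier → Set
    InΣ T c = Σ (List Carrier) λ U → U ⊆ T × sumS U ≡ just c

    InSt : Carrier → Carrier → Set
    InSt f c = c ⊕ f ≡ f

-- Semigroup ring R[X;S], for finite S: elements are functions S → R
-- (every function has finite support), with convolution product.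

module SemigroupRing {c ℓ : Level} (S : FinCommSemigroup) (R : CommutativeRing c ℓ) where
  open FinCommSemigroup S
  open CommutativeRing R renaming (Carrier to K)

  RS : Set c
  RS = Carrier → K

  X^ : Carrier → RS
  X^ s u with s ≟ u
  ... | yes _ = 1#
  ... | no  _ = 0#

  _⊞_ : RS → RS → RS
  (f ⊞ g) u = f u + g u

  _⊟_ : RS → RS → RS
  (f ⊟ g) u = f u - g u

  _⊛_ : K → RS → RS
  (a ⊛ f) u = a * f u

  Σ-elems : (Carrier → K) → K
  Σ-elems h = foldr (λ s r → h s + r) 0# elements

  _⊠_ : RS → RS → RS
  (f ⊠ g) u = Σ-elems λ s → Σ-elems λ t → coeff s t
    where
    coeff : Carrier → Carrier → K
    coeff s t with (s ⊕ t) ≟ u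
    ... | yes _ = f s * g t
    ... | no  _ = 0#

  zeroRS : RS
  zeroRS _ = 0#

  IsZero : RS → Set ℓ
  IsZero f = ∀ u → f u ≈ 0#

  -- product of a finite sequence of elements of R[X;S]
  -- (empty product is junk 0; R[X;S] need not have a unit; only used for nonempty lists
  -- in the theorem, or where the empty case is harmless)
  prodRS : List RS → RS
  prodRS [] = zeroRS
  prodRS (f ∷ []) = f
  prodRS (f ∷ g ∷ gs) = f ⊠ prodRS (g ∷ gs)

  natR : ℕ → K
  natR zero = 0#
  natR (suc n) = 1# + natR n

  HasCharacteristic : ℕ → Set ℓ
  HasCharacteristic p = natR p ≈ 0# × (∀ m → 1 ≤ m → m < p → ¬ (natR m ≈ 0#))

{-# OPTIONS --safe #-}
-- Compute in a unital commutative ring containing the X^s, written [s].  Since R has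
-- characteristic p and every period divides exp(S), a power of p, each Δ s = [s] − [e(s)]
-- satisfies Δ s ^ ρ(s) = 0: on the (1 − [e s])-component it is killed by [s]^ρ(s) = [e s],
-- and on the [e s]-component Δ s becomes [e s][s] − [e s], whose period(s)-th power vanishes
-- by the Frobenius map.  If A generates S, every Δ s lies in the ideal generated by Δ(A)
-- (expand Δ (x + y) through Δ x and Δ y), so by pigeonhole any product of
-- 1 + Σ_{a ∈ A} (ρ(a) − 1) elements of that ideal vanishes.  This is the vanishing in (i),
-- and (ii) follows by taking all aᵢ = 1.  For the stabiliser, multiply the vanishing product
-- by X^e: as e absorbs every e(sᵢ), it becomes Σ_U ± X^(e + ΣU) over the subsequences U of T,
-- whose term for U = [] is ±X^e; it must cancel, so e + ΣU = e for some nonempty U.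
module Submission where

open import Defs
open import Level using (Level; _⊔_; 0ℓ)
open import Algebra.Bundles using (CommutativeRing; CommutativeSemigroup)
open import Algebra.Structures using (IsCommutativeRing)
open import Data.Nat as ℕ using (ℕ; zero; suc; _≤_; _<_; _∸_; z≤n; s≤s)
import Data.Nat.Properties as ℕₚ
open import Data.Nat.Primality using (Prime)
open import Data.Nat.Divisibility using (_∣_)
open import Data.List.Properties using (length-map)
open import Data.List using (List; []; _∷_; _++_; foldr; map; length; zipWith; replicate)
open import Data.List.Membership.Propositional using (_∈_)
open import Data.List.Relation.Unary.Any using (here; there)
open import Data.List.Relation.Unary.All as All using (All; []; _∷_)
import Data.List.Relation.Unary.All.Properties as All
open import Data.List.Relation.Unary.Unique.Propositional using (Unique)
import Data.List.Relation.Unary.AllPairs as AllPairs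
open import Data.List.Relation.Binary.Sublist.Propositional using (_⊆_; []; _∷_; _∷ʳ_)
open import Data.Maybe using (Maybe; just; nothing)
open import Data.Maybe.Properties using (just-injective)
open import Data.Product using (Σ; ∃; _,_; proj₁; proj₂)
open import Data.Sum using (_⊎_; inj₁; inj₂)
open import Function using (_∘_)
open import Relation.Nullary using (¬_; yes; no; contradiction)
open import Relation.Binary.PropositionalEquality as ≡ using (_≡_; _≢_)

module PrimeArithmetic where

  open import Data.Nat
  open import Data.Nat.Properties
  open import Data.Nat.Divisibility
  open import Data.Nat.Primality using (euclidsLemma; prime⇒irreducible; prime⇒nonZero)
  open import Data.Nat.Combinatorics using (_C_; k![n∸k]!∣n!)
  open import Data.Nat.Combinatorics.Specification using (nCk≡n!/k![n-k]!)
  open import Data.Nat.DivMod using (m/n*n≡m)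
  open import Data.Nat.Coprimality using (Coprime; coprime-divisor)
  open import Relation.Binary.PropositionalEquality using (sym; trans; cong; subst; refl)

  prime⇒≥2 : ∀ {p} → Prime p → 2 ≤ p
  prime⇒≥2 {2+ _} _ = s≤s (s≤s z≤n)

  prime∤m! : ∀ {p} → Prime p → ∀ {m} → m < p → ¬ (p ∣ m !)
  prime∤m! pr {zero}  m<p p∣1 = <-irrefl (sym (∣1⇒≡1 p∣1)) (prime⇒≥2 pr)
  prime∤m! pr {suc m} m<p p∣m! with euclidsLemma (suc m) (m !) pr p∣m!
  ... | inj₁ p∣1+m = <⇒≱ m<p (∣⇒≤ p∣1+m)
  ... | inj₂ p∣m!  = prime∤m! pr (<-trans (n<1+n m) m<p) p∣m!

  n∣n! : ∀ {n} → .{{NonZero n}} → n ∣ n !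
  n∣n! {suc n} = m∣m*n (n !)

  nCk*k![n∸k]!≡n! : ∀ {n k} → k ≤ n → (n C k) * (k ! * (n ∸ k) !) ≡ n !
  nCk*k![n∸k]!≡n! {n} {k} k≤n =
    trans (cong (_* (k ! * (n ∸ k) !)) (nCk≡n!/k![n-k]! k≤n)) (m/n*n≡m (k![n∸k]!∣n! k≤n))
    where instance _ = k !* (n ∸ k) !≢0

  prime∣pCk : ∀ {p} → Prime p → ∀ {k} → 0 < k → k < p → p ∣ p C k
  prime∣pCk {p} pr {k} 0<k k<p
    with euclidsLemma (p C k) (k ! * (p ∸ k) !) pr
           (subst (p ∣_) (sym (nCk*k![n∸k]!≡n! (<⇒≤ k<p))) (n∣n! {{prime⇒nonZero pr}}))
  ... | inj₁ p∣pCk = p∣pCk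
  ... | inj₂ p∣k!*[p∸k]! with euclidsLemma (k !) ((p ∸ k) !) pr p∣k!*[p∸k]!
  ...   | inj₁ p∣k!     = contradiction p∣k! (prime∤m! pr k<p)
  ...   | inj₂ p∣[p∸k]! = contradiction p∣[p∸k]! (prime∤m! pr (∸-monoʳ-< 0<k (<⇒≤ k<p)))

  ∣p^r⇒≡p^j : ∀ {p} → Prime p → ∀ r {d} → d ∣ p ^ r → ∃ λ j → d ≡ p ^ j
  ∣p^r⇒≡p^j pr zero d∣1 = 0 , ∣1⇒≡1 d∣1
  ∣p^r⇒≡p^j {p} pr (suc r) {d} d∣p^1+r with p ∣? d
  ... | yes (divides q refl) =
    let j , q≡p^j = ∣p^r⇒≡p^j pr r q∣p^r in suc j , trans (cong (_* p) q≡p^j) (*-comm (p ^ j) p)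
    where
    instance _ = prime⇒nonZero pr
    q∣p^r : q ∣ p ^ r
    q∣p^r = *-cancelʳ-∣ p (subst (q * p ∣_) (*-comm p (p ^ r)) d∣p^1+r)
  ... | no p∤d = ∣p^r⇒≡p^j pr r (coprime-divisor d⊥p d∣p^1+r)
    where
    d⊥p : Coprime d p
    d⊥p (i∣d , i∣p) with prime⇒irreducible pr i∣p
    ... | inj₁ i≡1 = i≡1
    ... | inj₂ refl = contradiction i∣d p∤d


open PrimeArithmetic using (prime⇒≥2; prime∣pCk; ∣p^r⇒≡p^j)


module CommutativeRingLemmas {c ℓ} (R : CommutativeRing c ℓ) where
  open CommutativeRing R hiding (zero)
  open import Algebra.Properties.Ring ring using (x[y-z]≈xy-xz; [y-z]x≈yx-zx; -0#≈0#)
  open import Algebra.Properties.CommutativeSemigroup *-commutativeSemigroup using (x∙yz≈y∙xz; x∙yz≈yx∙z)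
  open import Algebra.Properties.Semiring.Exp semiring using (_^_; ^-congˡ; ^-congʳ; ^-homo-*)
  open import Algebra.Properties.CommutativeSemiring.Exp commutativeSemiring using (^-distrib-*)
  open import Relation.Binary.Reasoning.Setoid setoid

  [x-y]+[y-z]≈x-z : ∀ x y z → (x - y) + (y - z) ≈ x - z
  [x-y]+[y-z]≈x-z x y z = begin
    (x - y) + (y - z)     ≈⟨ +-assoc x (- y) (y - z) ⟩
    x + (- y + (y - z))   ≈⟨ +-congˡ (+-assoc (- y) y (- z)) ⟨
    x + ((- y + y) - z)   ≈⟨ +-congˡ (+-congʳ (-‿inverseˡ y)) ⟩
    x + (0# - z)          ≈⟨ +-congˡ (+-identityˡ (- z)) ⟩
    x - z                 ∎

  x[y-v]+v[x-u]≈xy-uv : ∀ x y u v → x * (y - v) + v * (x - u) ≈ x * y - u * v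
  x[y-v]+v[x-u]≈xy-uv x y u v = begin
    x * (y - v) + v * (x - u)           ≈⟨ +-cong (x[y-z]≈xy-xz x y v) (x[y-z]≈xy-xz v x u) ⟩
    (x * y - x * v) + (v * x - v * u)   ≈⟨ +-congˡ (+-cong (*-comm v x) (-‿cong (*-comm v u))) ⟩
    (x * y - x * v) + (x * v - u * v)   ≈⟨ [x-y]+[y-z]≈x-z _ _ _ ⟩
    x * y - u * v                       ∎

  module _ {y} (y*y≈y : y * y ≈ y) where

    idempotent-^ : ∀ {m} → 1 ≤ m → y ^ m ≈ y
    idempotent-^ {suc zero}    _ = *-identityʳ y
    idempotent-^ {suc (suc m)} _ = trans (*-congˡ (idempotent-^ {suc m} (s≤s z≤n))) y*y≈y

    y*[1-y]≈0 : y * (1# - y) ≈ 0#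
    y*[1-y]≈0 = trans (x[y-z]≈xy-xz y 1# y) (trans (+-cong (*-identityʳ y) (-‿cong y*y≈y)) (-‿inverseʳ y))

    [x-y]^m*[1-y]≈x^m*[1-y] : ∀ x m → (x - y) ^ m * (1# - y) ≈ x ^ m * (1# - y)
    [x-y]^m*[1-y]≈x^m*[1-y] x zero    = refl
    [x-y]^m*[1-y]≈x^m*[1-y] x (suc m) = begin
      ((x - y) * (x - y) ^ m) * z       ≈⟨ *-assoc _ _ _ ⟩
      (x - y) * ((x - y) ^ m * z)       ≈⟨ *-congˡ ([x-y]^m*[1-y]≈x^m*[1-y] x m) ⟩
      (x - y) * (x ^ m * z)             ≈⟨ x∙yz≈y∙xz (x - y) (x ^ m) z ⟩
      x ^ m * ((x - y) * z)             ≈⟨ *-congˡ [x-y]*[1-y]≈x*[1-y] ⟩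
      x ^ m * (x * z)                   ≈⟨ x∙yz≈yx∙z (x ^ m) x z ⟩
      (x * x ^ m) * z                   ∎
      where
      z = 1# - y
      [x-y]*[1-y]≈x*[1-y] : (x - y) * z ≈ x * z
      [x-y]*[1-y]≈x*[1-y] = trans ([y-z]x≈yx-zx z x y)
        (trans (+-congˡ (trans (-‿cong y*[1-y]≈0) -0#≈0#)) (+-identityʳ _))

    [x-y]^r≈0 : ∀ {x n r} → x ^ r ≈ y → (y * x - y) ^ n ≈ 0# → n ≤ r → (x - y) ^ r ≈ 0#
    [x-y]^r≈0 {x} {n} {zero}  _     [yx-y]^n≈0 z≤n = [yx-y]^n≈0
    [x-y]^r≈0 {x} {n} {suc r} x^r≈y [yx-y]^n≈0 n≤r = begin
      (x - y) ^ suc r                                     ≈⟨ *-identityʳ _ ⟨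
      (x - y) ^ suc r * 1#                                ≈⟨ *-congˡ y+[1-y]≈1 ⟨
      (x - y) ^ suc r * (y + (1# - y))                    ≈⟨ distribˡ _ _ _ ⟩
      (x - y) ^ suc r * y + (x - y) ^ suc r * (1# - y)    ≈⟨ +-cong on-y off-y ⟩
      0# + 0#                                             ≈⟨ +-identityʳ 0# ⟩
      0#                                                  ∎
      where
      y+[1-y]≈1 : y + (1# - y) ≈ 1#
      y+[1-y]≈1 = trans (+-comm y _) (trans (+-assoc 1# (- y) y) (trans (+-congˡ (-‿inverseˡ y)) (+-identityʳ 1#)))
      on-y : (x - y) ^ suc r * y ≈ 0#
      on-y = begin
        (x - y) ^ suc r * y                        ≈⟨ *-comm _ _ ⟩
        y * (x - y) ^ suc r                        ≈⟨ *-congʳ (idempotent-^ {suc r} (s≤s z≤n)) ⟨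
        y ^ suc r * (x - y) ^ suc r                ≈⟨ ^-distrib-* y (x - y) (suc r) ⟨
        (y * (x - y)) ^ suc r
          ≈⟨ ^-congˡ (suc r) (trans (x[y-z]≈xy-xz y x y) (+-congˡ (-‿cong y*y≈y))) ⟩
        (y * x - y) ^ suc r                        ≈⟨ ^-congʳ (y * x - y) (ℕₚ.m+[n∸m]≡n n≤r) ⟨
        (y * x - y) ^ (n ℕ.+ (suc r ∸ n))          ≈⟨ ^-homo-* (y * x - y) n (suc r ∸ n) ⟩
        (y * x - y) ^ n * (y * x - y) ^ (suc r ∸ n) ≈⟨ *-congʳ [yx-y]^n≈0 ⟩
        0# * (y * x - y) ^ (suc r ∸ n)             ≈⟨ zeroˡ _ ⟩
        0#                                         ∎
      off-y : (x - y) ^ suc r * (1# - y) ≈ 0#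
      off-y = begin
        (x - y) ^ suc r * (1# - y)   ≈⟨ [x-y]^m*[1-y]≈x^m*[1-y] x (suc r) ⟩
        x ^ suc r * (1# - y)         ≈⟨ *-congʳ x^r≈y ⟩
        y * (1# - y)                 ≈⟨ y*[1-y]≈0 ⟩
        0#                           ∎


module Frobenius {c ℓ} (R : CommutativeRing c ℓ) {p : ℕ} (p-prime : Prime p) where
  open import Data.Nat.Divisibility using (divides)
  open import Data.Nat.Combinatorics using (_C_; nCn≡1)
  open import Data.Fin using (Fin; zero; suc; toℕ; fromℕ; inject₁)
  import Data.Fin.Properties as Fin
  open CommutativeRing R hiding (zero)
  open import Algebra.Properties.Ring ring using (+-identityˡ-unique)
  open import Algebra.Properties.Semiring.Mult semiring using (_×_; ×-congˡ; ×-assocˡ)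
  open import Algebra.Properties.Semiring.Exp semiring using (_^_; ^-congˡ; ^-congʳ; ^-assocʳ)
  open import Algebra.Properties.CommutativeSemiring.Binomial commutativeSemiring
    using (theorem; binomial; binomialTerm)
  open import Algebra.Properties.Monoid.Sum +-monoid
    using (sum; sum-init-last; sum-cong-≋; sum-replicate-zero)
  open import Relation.Binary.Reasoning.Setoid setoid

  module _ (p×≈0 : ∀ x → p × x ≈ 0#) where

    frobenius : ∀ x y → (x + y) ^ p ≈ x ^ p + y ^ p
    frobenius x y = at-p p ≡.refl
      where
      at-p : ∀ n → n ≡ p → (x + y) ^ n ≈ x ^ n + y ^ n
      at-p (suc q) ≡.refl = begin
        (x + y) ^ suc q                               ≈⟨ theorem (suc q) x y ⟩
        sum term                                      ≈⟨ +-congˡ (sum-init-last (λ i → term (suc i))) ⟩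
        term zero + (sum (λ i → term (suc (inject₁ i))) + term (fromℕ (suc q)))
                                                      ≈⟨ +-congˡ (+-congʳ (sum-cong-≋ inner≈0)) ⟩
        term zero + (sum (λ (_ : Fin q) → 0#) + term (fromℕ (suc q)))
                                                      ≈⟨ +-congˡ (+-congʳ (sum-replicate-zero q)) ⟩
        term zero + (0# + term (fromℕ (suc q)))       ≈⟨ +-cong first≈ (+-identityˡ _) ⟩
        y ^ suc q + term (fromℕ (suc q))              ≈⟨ +-comm _ _ ⟩
        term (fromℕ (suc q)) + y ^ suc q
          ≈⟨ +-congʳ (last≈ (toℕ (fromℕ (suc q))) (Fin.toℕ-fromℕ (suc q))) ⟩
        x ^ suc q + y ^ suc q                         ∎
        where
        term = binomialTerm x y (suc q)
        inner≈0 : ∀ (i : Fin q) → term (suc (inject₁ i)) ≈ 0#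
        inner≈0 i with prime∣pCk p-prime (s≤s z≤n) (s≤s (≡.subst (_< q) (≡.sym (Fin.toℕ-inject₁ i)) (Fin.toℕ<n i)))
        ... | divides m eq = begin
          term (suc (inject₁ i)) ≈⟨ ×-congˡ (≡.trans eq (ℕₚ.*-comm m (suc q))) ⟩
          (suc q ℕ.* m) × b      ≈⟨ sym (×-assocˡ b (suc q) m) ⟩
          suc q × (m × b)        ≈⟨ p×≈0 (m × b) ⟩
          0#                     ∎
          where b = binomial x y (suc q) (suc (inject₁ i))
        first≈ : term zero ≈ y ^ suc q
        first≈ = trans (+-identityʳ _) (*-identityˡ _)
        last≈ : ∀ k → k ≡ suc q → ((suc q) C k) × (x ^ k * y ^ (suc q ∸ k)) ≈ x ^ suc q
        last≈ k ≡.refl = begin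
          ((suc q) C suc q) × (x ^ suc q * y ^ (q ∸ q)) ≈⟨ ×-congˡ (nCn≡1 (suc q)) ⟩
          x ^ suc q * y ^ (q ∸ q) + 0#                  ≈⟨ +-identityʳ _ ⟩
          x ^ suc q * y ^ (q ∸ q)                       ≈⟨ *-congˡ (^-congʳ y (ℕₚ.n∸n≡0 q)) ⟩
          x ^ suc q * 1#                                ≈⟨ *-identityʳ _ ⟩
          x ^ suc q                                     ∎

    frobenius-^ : ∀ j x y → (x + y) ^ (p ℕ.^ j) ≈ x ^ (p ℕ.^ j) + y ^ (p ℕ.^ j)
    frobenius-^ zero x y = trans (*-identityʳ _) (sym (+-cong (*-identityʳ x) (*-identityʳ y)))
    frobenius-^ (suc j) x y = begin
      (x + y) ^ (p ℕ.* p ℕ.^ j)                ≈⟨ sym (^-assocʳ (x + y) p (p ℕ.^ j)) ⟩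
      ((x + y) ^ p) ^ (p ℕ.^ j)                ≈⟨ ^-congˡ (p ℕ.^ j) (frobenius x y) ⟩
      (x ^ p + y ^ p) ^ (p ℕ.^ j)              ≈⟨ frobenius-^ j (x ^ p) (y ^ p) ⟩
      (x ^ p) ^ (p ℕ.^ j) + (y ^ p) ^ (p ℕ.^ j) ≈⟨ +-cong (^-assocʳ x p (p ℕ.^ j)) (^-assocʳ y p (p ℕ.^ j)) ⟩
      x ^ (p ℕ.* p ℕ.^ j) + y ^ (p ℕ.* p ℕ.^ j) ∎

    x^q≈y^q⇒[x-y]^q≈0 : ∀ j {x y} → x ^ (p ℕ.^ j) ≈ y ^ (p ℕ.^ j) → (x - y) ^ (p ℕ.^ j) ≈ 0#
    x^q≈y^q⇒[x-y]^q≈0 j {x} {y} x^q≈y^q = +-identityˡ-unique ((x - y) ^ q) (y ^ q) (begin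
      (x - y) ^ q + y ^ q       ≈⟨ sym (frobenius-^ j (x - y) y) ⟩
      ((x - y) + y) ^ q         ≈⟨ ^-congˡ q x-y+y≈x ⟩
      x ^ q                     ≈⟨ x^q≈y^q ⟩
      y ^ q                     ∎)
      where
      q = p ℕ.^ j
      x-y+y≈x : (x - y) + y ≈ x
      x-y+y≈x = trans (+-assoc x (- y) y) (trans (+-congˡ (-‿inverseˡ y)) (+-identityʳ x))


module Ideals {c ℓ} (R : CommutativeRing c ℓ) {I : Set} (g : I → CommutativeRing.Carrier R) where
  open import Data.Nat.ListAction using (sum)
  open CommutativeRing R hiding (zero)
  open import Algebra.Properties.Ring ring using (-1*x≈-x)
  open import Algebra.Properties.CommutativeSemigroup +-commutativeSemigroup using (interchange)
  open import Algebra.Properties.Semiring.Exp semiring using (_^_; ^-congʳ; ^-homo-*)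
  open import Algebra.Solver.CommutativeMonoid *-commutativeMonoid using (solve; _⊜_) renaming (_⊕_ to _⊗_)
  open import Relation.Binary.Reasoning.Setoid setoid

  data InIdeal : List I → Carrier → Set (c ⊔ ℓ) where
    nil  : ∀ {z} → z ≈ 0# → InIdeal [] z
    cons : ∀ {b A z} a {z′} → InIdeal A z′ → z ≈ a * g b + z′ → InIdeal (b ∷ A) z

  InIdeal-cong : ∀ {A z z′} → z ≈ z′ → InIdeal A z → InIdeal A z′
  InIdeal-cong z≈z′ (nil z≈0)       = nil (trans (sym z≈z′) z≈0)
  InIdeal-cong z≈z′ (cons a z″∈I z≈) = cons a z″∈I (trans (sym z≈z′) z≈)

  InIdeal-0 : ∀ A → InIdeal A 0#
  InIdeal-0 []      = nil refl
  InIdeal-0 (b ∷ A) = cons 0# (InIdeal-0 A) (sym (trans (+-identityʳ _) (zeroˡ _)))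

  InIdeal-+ : ∀ {A z z′} → InIdeal A z → InIdeal A z′ → InIdeal A (z + z′)
  InIdeal-+ (nil z≈0) (nil z′≈0) = nil (trans (+-cong z≈0 z′≈0) (+-identityˡ 0#))
  InIdeal-+ {b ∷ _} (cons a y∈I z≈) (cons a′ y′∈I z′≈) = cons (a + a′) (InIdeal-+ y∈I y′∈I) (begin
    _ + _                              ≈⟨ +-cong z≈ z′≈ ⟩
    (a * g b + _) + (a′ * g b + _)     ≈⟨ interchange _ _ _ _ ⟩
    (a * g b + a′ * g b) + (_ + _)     ≈⟨ +-congʳ (sym (distribʳ (g b) a a′)) ⟩
    (a + a′) * g b + (_ + _)           ∎)

  InIdeal-* : ∀ {A z} x → InIdeal A z → InIdeal A (x * z)
  InIdeal-* x (nil z≈0) = nil (trans (*-congˡ z≈0) (zeroʳ x))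
  InIdeal-* {b ∷ _} x (cons a y∈I z≈) = cons (x * a) (InIdeal-* x y∈I) (begin
    x * _                     ≈⟨ *-congˡ z≈ ⟩
    x * (a * g b + _)         ≈⟨ distribˡ x _ _ ⟩
    x * (a * g b) + x * _     ≈⟨ +-congʳ (sym (*-assoc x a (g b))) ⟩
    x * a * g b + x * _       ∎)

  InIdeal-- : ∀ {A z} → InIdeal A z → InIdeal A (- z)
  InIdeal-- z∈I = InIdeal-cong (-1*x≈-x _) (InIdeal-* (- 1#) z∈I)

  g∈InIdeal : ∀ {A b} → b ∈ A → InIdeal A (g b)
  g∈InIdeal {b ∷ A} (here ≡.refl) = cons 1# (InIdeal-0 A) (sym (trans (+-identityʳ _) (*-identityˡ _)))
  g∈InIdeal {b′ ∷ A} (there b∈A) = cons 0# (g∈InIdeal b∈A) (sym (trans (+-congʳ (zeroˡ _)) (+-identityˡ _)))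

  ∏ : List Carrier → Carrier
  ∏ = foldr _*_ 1#

  module _ (n : I → ℕ) (g^n≈0 : ∀ i → g i ^ n i ≈ 0#) where

    slack : List I → ℕ
    slack A = sum (map (λ b → n b ∸ 1) A)

    g^≈0 : ∀ b {m} → n b ≤ m → g b ^ m ≈ 0#
    g^≈0 b {m} n≤m = begin
      g b ^ m                          ≈⟨ ^-congʳ (g b) (≡.sym (ℕₚ.m+[n∸m]≡n n≤m)) ⟩
      g b ^ (n b ℕ.+ (m ∸ n b))        ≈⟨ ^-homo-* (g b) (n b) (m ∸ n b) ⟩
      g b ^ n b * g b ^ (m ∸ n b)      ≈⟨ *-congʳ (g^n≈0 b) ⟩
      0# * g b ^ (m ∸ n b)             ≈⟨ zeroˡ _ ⟩
      0#                               ∎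

    -- Writing each D ∈ Ds as a * g b + D′, every term of the expansion of
    -- g b ^ m * ∏ Ds * ∏ Es has at least n b factors g b or more than
    -- slack A factors from the ideal of A.
    module _ (b : I) (A : List I)
             (∏≈0-A : ∀ Es → All (InIdeal A) Es → suc (slack A) ≤ length Es → ∏ Es ≈ 0#) where

      ∏≈0-step : ∀ Ds → All (InIdeal (b ∷ A)) Ds → ∀ m Es → All (InIdeal A) Es →
                 suc (slack (b ∷ A)) ≤ m ℕ.+ length Ds ℕ.+ length Es →
                 g b ^ m * (∏ Ds * ∏ Es) ≈ 0#
      ∏≈0-step [] [] m Es Es∈I long with n b ℕₚ.≤? m
      ... | yes n≤m = trans (*-congʳ (g^≈0 b n≤m)) (zeroˡ _)
      ... | no  n≰m = trans (*-congˡ (trans (*-identityˡ _) (∏≈0-A Es Es∈I long′))) (zeroʳ _)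
        where
        k = n b ∸ 1
        long′ : suc (slack A) ≤ length Es
        long′ = ℕₚ.+-cancelˡ-≤ k _ _
          (ℕₚ.≤-trans (ℕₚ.≤-reflexive (ℕₚ.+-suc k (slack A))) (ℕₚ.≤-trans long (ℕₚ.+-monoˡ-≤ (length Es) m≤k)))
          where
          m≤k : m ℕ.+ 0 ≤ k
          m≤k = ℕₚ.≤-trans (ℕₚ.≤-reflexive (ℕₚ.+-identityʳ m)) (ℕₚ.∸-monoˡ-≤ 1 (ℕₚ.≰⇒> n≰m))
      ∏≈0-step (D ∷ Ds) (cons a {D′} D′∈I D≈ ∷ Ds∈I) m Es Es∈I long = begin
        X * ((D * P) * Q)                              ≈⟨ *-congˡ (trans (*-assoc D P Q) (*-congʳ D≈)) ⟩
        X * ((a * g b + D′) * (P * Q))                 ≈⟨ *-congˡ (distribʳ (P * Q) (a * g b) D′) ⟩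
        X * ((a * g b) * (P * Q) + D′ * (P * Q))       ≈⟨ distribˡ X _ _ ⟩
        X * ((a * g b) * (P * Q)) + X * (D′ * (P * Q)) ≈⟨ +-cong (regroup₁ X a (g b) P Q) (regroup₂ X D′ P Q) ⟩
        a * (g b ^ suc m * (P * Q)) + X * (P * (D′ * Q))
          ≈⟨ +-cong (*-congˡ (∏≈0-step Ds Ds∈I (suc m) Es Es∈I long₁))
                    (∏≈0-step Ds Ds∈I m (D′ ∷ Es) (D′∈I ∷ Es∈I) long₂) ⟩
        a * 0# + 0#                                    ≈⟨ trans (+-identityʳ _) (zeroʳ a) ⟩
        0#                                             ∎
        where
        X = g b ^ m
        P = ∏ Ds
        Q = ∏ Es
        regroup₁ : ∀ x a y p q → x * ((a * y) * (p * q)) ≈ a * ((y * x) * (p * q))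
        regroup₁ = solve 5 (λ x a y p q → x ⊗ ((a ⊗ y) ⊗ (p ⊗ q)) ⊜ a ⊗ ((y ⊗ x) ⊗ (p ⊗ q))) refl
        regroup₂ : ∀ x d p q → x * (d * (p * q)) ≈ x * (p * (d * q))
        regroup₂ = solve 4 (λ x d p q → x ⊗ (d ⊗ (p ⊗ q)) ⊜ x ⊗ (p ⊗ (d ⊗ q))) refl
        long₁ : suc (slack (b ∷ A)) ≤ suc m ℕ.+ length Ds ℕ.+ length Es
        long₁ = ℕₚ.≤-trans long (ℕₚ.≤-reflexive (≡.cong (ℕ._+ length Es) (ℕₚ.+-suc m (length Ds))))
        long₂ : suc (slack (b ∷ A)) ≤ m ℕ.+ length Ds ℕ.+ suc (length Es)
        long₂ = ℕₚ.≤-trans long (ℕₚ.≤-reflexive (≡.trans (≡.cong (ℕ._+ length Es) (ℕₚ.+-suc m (length Ds)))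
                                                         (≡.sym (ℕₚ.+-suc (m ℕ.+ length Ds) (length Es)))))

    ∏≈0 : ∀ A Ds → All (InIdeal A) Ds → suc (slack A) ≤ length Ds → ∏ Ds ≈ 0#
    ∏≈0 []      (D ∷ _) (nil D≈0 ∷ _) _ = trans (*-congʳ D≈0) (zeroˡ _)
    ∏≈0 (b ∷ A) Ds Ds∈I long = begin
      ∏ Ds                       ≈⟨ sym (trans (*-identityˡ _) (*-identityʳ _)) ⟩
      g b ^ 0 * (∏ Ds * ∏ [])    ≈⟨ ∏≈0-step b A (∏≈0 A) Ds Ds∈I 0 [] [] long′ ⟩
      0#                         ∎
      where
      long′ : suc (slack (b ∷ A)) ≤ length Ds ℕ.+ 0
      long′ = ℕₚ.≤-trans long (ℕₚ.≤-reflexive (≡.sym (ℕₚ.+-identityʳ (length Ds))))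


module CyclicSubsemigroups (S : FinCommSemigroup) (D : SemigroupNotions.CyclicData S) where
  open import Data.Nat using (_+_; _*_)
  open import Data.Nat.Divisibility using (∣-trans)
  open import Data.Nat.LCM using (lcm; m∣lcm[m,n]; n∣lcm[m,n])
  open import Algebra.Properties.CommutativeSemigroup ℕₚ.+-commutativeSemigroup
    using (xy∙z≈xz∙y; x∙yz≈xz∙y; interchange)
  open import Relation.Binary.PropositionalEquality
  open FinCommSemigroup S
  open SemigroupNotions S
  open CyclicData D
  open WithData D

  ⊕-commutativeSemigroup : CommutativeSemigroup 0ℓ 0ℓ
  ⊕-commutativeSemigroup = record
    { isCommutativeSemigroup = record
      { isSemigroup = record
        { isMagma = record { isEquivalence = isEquivalence ; ∙-cong = cong₂ _⊕_ }
        ; assoc   = assoc }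
      ; comm = comm } }

  open import Algebra.Properties.CommutativeSemigroup ⊕-commutativeSemigroup
    using () renaming (interchange to ⊕-interchange)

  idempotent-⊕ : ∀ {a b} → IsIdempotent a → IsIdempotent b → IsIdempotent (a ⊕ b)
  idempotent-⊕ {a} {b} a⊕a≡a b⊕b≡b = trans (⊕-interchange a b a b) (cong₂ _⊕_ a⊕a≡a b⊕b≡b)

  ·-homo-+ : ∀ x {i j} → 1 ≤ i → 1 ≤ j → (i + j) · x ≡ i · x ⊕ j · x
  ·-homo-+ x {suc zero}    {suc j} _ _   = refl
  ·-homo-+ x {suc (suc i)} {j}     _ 1≤j =
    trans (cong (x ⊕_) (·-homo-+ x {suc i} (s≤s z≤n) 1≤j)) (sym (assoc x _ _))

  idempotent⇒·-fixed : ∀ {u} → IsIdempotent u → ∀ m → m · u ≡ u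
  idempotent⇒·-fixed u⊕u≡u zero          = refl
  idempotent⇒·-fixed u⊕u≡u (suc zero)    = refl
  idempotent⇒·-fixed u⊕u≡u (suc (suc m)) = trans (cong (_ ⊕_) (idempotent⇒·-fixed u⊕u≡u (suc m))) u⊕u≡u

  period∣expS : ∀ x → period x ∣ expS
  period∣expS x = go (elems-complete x)
    where
    go : ∀ {L} → x ∈ L → period x ∣ foldr (λ y r → lcm (period y) r) 1 L
    go {y ∷ _} (here refl)  = m∣lcm[m,n] (period y) _
    go {y ∷ _} (there x∈L) = ∣-trans (go x∈L) (n∣lcm[m,n] (period y) _)

  1≤period : ∀ x → 1 ≤ period x
  1≤period x = proj₁ (proj₂ (proj₂ (period-spec x)))

  module _ (x : Carrier) where
    private
      k = proj₁ (period-spec x)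
      n = period x
      k-index : IsIndex x k
      k-index = proj₁ (proj₂ (period-spec x))
      1≤k : 1 ≤ k
      1≤k = proj₁ k-index
      1≤n : 1 ≤ n
      1≤n = 1≤period x
      1≤ρ : 1 ≤ ρ x
      1≤ρ = ρ-pos x
      period-least : ∀ m → 1 ≤ m → m < n → (k + m) · x ≢ k · x
      period-least = proj₂ (proj₂ (proj₂ (proj₂ (period-spec x))))

      k+n≡k : (k + n) · x ≡ k · x
      k+n≡k = proj₁ (proj₂ (proj₂ (proj₂ (period-spec x))))

    period-shift : ∀ {m} → k ≤ m → (m + n) · x ≡ m · x
    period-shift k≤m = subst (λ m → (m + n) · x ≡ m · x) (ℕₚ.m+[n∸m]≡n k≤m) (from-index _)
      where
      open ≡-Reasoning
      from-index : ∀ d → (k + d + n) · x ≡ (k + d) · x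
      from-index zero = begin
        (k + 0 + n) · x         ≡⟨ cong (λ m → (m + n) · x) (ℕₚ.+-identityʳ k) ⟩
        (k + n) · x             ≡⟨ k+n≡k ⟩
        k · x                   ≡⟨ cong (_· x) (sym (ℕₚ.+-identityʳ k)) ⟩
        (k + 0) · x             ∎
      from-index (suc d) = begin
        (k + suc d + n) · x     ≡⟨ cong (_· x) (xy∙z≈xz∙y k (suc d) n) ⟩
        (k + n + suc d) · x     ≡⟨ ·-homo-+ x (ℕₚ.≤-trans 1≤k (ℕₚ.m≤m+n k n)) (s≤s z≤n) ⟩
        (k + n) · x ⊕ suc d · x ≡⟨ cong (_⊕ suc d · x) k+n≡k ⟩
        k · x ⊕ suc d · x       ≡⟨ sym (·-homo-+ x 1≤k (s≤s z≤n)) ⟩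
        (k + suc d) · x         ∎

    periodic : ∀ {m} → k ≤ m → ∀ q → (m + q * n) · x ≡ m · x
    periodic {m} k≤m zero    = cong (_· x) (ℕₚ.+-identityʳ m)
    periodic {m} k≤m (suc q) = begin
      (m + (n + q * n)) · x   ≡⟨ cong (_· x) (x∙yz≈xz∙y m n (q * n)) ⟩
      (m + q * n + n) · x     ≡⟨ period-shift (ℕₚ.≤-trans k≤m (ℕₚ.m≤m+n m (q * n))) ⟩
      (m + q * n) · x         ≡⟨ periodic k≤m q ⟩
      m · x                   ∎
      where open ≡-Reasoning

    [ρ+ρ]·x≡ρ·x : (ρ x + ρ x) · x ≡ ρ x · x
    [ρ+ρ]·x≡ρ·x = begin
      (ρ x + ρ x) · x        ≡⟨ ·-homo-+ x 1≤ρ 1≤ρ ⟩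
      ρ x · x ⊕ ρ x · x      ≡⟨ cong₂ _⊕_ (ρ-spec x) (ρ-spec x) ⟩
      e x ⊕ e x              ≡⟨ e-idem x ⟩
      e x                    ≡⟨ sym (ρ-spec x) ⟩
      ρ x · x                ∎
      where open ≡-Reasoning

    index≤ρ : k ≤ ρ x
    index≤ρ = ℕₚ.≮⇒≥ (λ ρ<k → proj₂ (proj₂ k-index) (ρ x) 1≤ρ ρ<k (ρ x , 1≤ρ , [ρ+ρ]·x≡ρ·x))

    e⊕period·≡e : e x ⊕ n · x ≡ e x
    e⊕period·≡e = begin
      e x ⊕ n · x            ≡⟨ cong (_⊕ n · x) (sym (ρ-spec x)) ⟩
      ρ x · x ⊕ n · x        ≡⟨ sym (·-homo-+ x 1≤ρ 1≤n) ⟩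
      (ρ x + n) · x          ≡⟨ cong (λ m → (ρ x + m) · x) (sym (ℕₚ.*-identityˡ n)) ⟩
      (ρ x + 1 * n) · x      ≡⟨ periodic index≤ρ 1 ⟩
      ρ x · x                ≡⟨ ρ-spec x ⟩
      e x                    ∎
      where open ≡-Reasoning

    period≤ρ : n ≤ ρ x
    period≤ρ = ℕₚ.≮⇒≥ (λ ρ<n → period-least (ρ x) 1≤ρ ρ<n k+ρ≡k)
      where
      r = ρ x
      r≤r*n : r ≤ r * n
      r≤r*n = ℕₚ.≤-trans (ℕₚ.≤-reflexive (sym (ℕₚ.*-identityʳ r))) (ℕₚ.*-monoʳ-≤ r 1≤n)
      a = r * n ∸ r
      1≤k+a : 1 ≤ k + a
      1≤k+a = ℕₚ.≤-trans 1≤k (ℕₚ.m≤m+n k a)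
      k+ρ≡k : (k + r) · x ≡ k · x
      k+ρ≡k = begin
        (k + r) · x               ≡⟨ sym (periodic (ℕₚ.m≤m+n k r) r) ⟩
        (k + r + r * n) · x       ≡⟨ cong (λ m → (k + r + m) · x) (sym (ℕₚ.m∸n+n≡m r≤r*n)) ⟩
        (k + r + (a + r)) · x     ≡⟨ cong (_· x) (interchange k r a r) ⟩
        (k + a + (r + r)) · x     ≡⟨ ·-homo-+ x 1≤k+a (ℕₚ.≤-trans 1≤ρ (ℕₚ.m≤m+n r r)) ⟩
        (k + a) · x ⊕ (r + r) · x ≡⟨ cong ((k + a) · x ⊕_) [ρ+ρ]·x≡ρ·x ⟩
        (k + a) · x ⊕ r · x       ≡⟨ sym (·-homo-+ x 1≤k+a 1≤ρ) ⟩
        (k + a + r) · x           ≡⟨ cong (_· x) (trans (ℕₚ.+-assoc k a r) (cong (k +_) (ℕₚ.m∸n+n≡m r≤r*n))) ⟩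
        (k + r * n) · x           ≡⟨ periodic ℕₚ.≤-refl r ⟩
        k · x                     ∎
        where open ≡-Reasoning


module Differences {c ℓ} (S : FinCommSemigroup) (D : SemigroupNotions.CyclicData S)
                   (R : CommutativeRing c ℓ)
                   (τ : FinCommSemigroup.Carrier S → CommutativeRing.Carrier R)
                   (τ-homo : ∀ s t → CommutativeRing._≈_ R (CommutativeRing._*_ R (τ s) (τ t))
                                                          (τ (FinCommSemigroup._⊕_ S s t))) where
  open FinCommSemigroup S
  open SemigroupNotions S
  open CyclicData D
  open WithData D
  open CyclicSubsemigroups S D
  open CommutativeRingLemmas R
  open CommutativeRing R hiding (zero) renaming (Carrier to K)
  open import Algebra.Properties.Ring ring using (⁻¹-anti-homo‿-)
  open import Algebra.Properties.Semiring.Exp semiring using (_^_)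
  open import Algebra.Properties.CommutativeSemiring.Exp commutativeSemiring using (^-distrib-*)
  open import Algebra.Properties.Semiring.Mult semiring using (_×_)
  open import Relation.Binary.Reasoning.Setoid setoid

  τ-cong : ∀ {s t} → s ≡ t → τ s ≈ τ t
  τ-cong ≡.refl = refl

  τ-^ : ∀ x {m} → 1 ≤ m → τ x ^ m ≈ τ (m · x)
  τ-^ x {suc zero}    _ = *-identityʳ _
  τ-^ x {suc (suc m)} _ = trans (*-congˡ (τ-^ x {suc m} (s≤s z≤n))) (τ-homo x _)

  Δ : Carrier → K
  Δ s = τ s - τ (e s)

  open Ideals R Δ using (InIdeal; InIdeal-cong; InIdeal-+; InIdeal-*; InIdeal--; g∈InIdeal; ∏; ∏≈0)

  module _ {A : List Carrier} where

    InIdeal-τ-⊕ : ∀ {x y x′ y′} → InIdeal A (τ x - τ x′) → InIdeal A (τ y - τ y′) →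
                  InIdeal A (τ (x ⊕ y) - τ (x′ ⊕ y′))
    InIdeal-τ-⊕ {x} {y} {x′} {y′} x-x′∈I y-y′∈I =
      InIdeal-cong (trans (x[y-v]+v[x-u]≈xy-uv (τ x) (τ y) (τ x′) (τ y′))
                          (+-cong (τ-homo x y) (-‿cong (τ-homo x′ y′))))
        (InIdeal-+ (InIdeal-* (τ x) y-y′∈I) (InIdeal-* (τ y′) x-x′∈I))

    InIdeal-τ-· : ∀ {v u} m → 1 ≤ m → InIdeal A (τ v - τ u) → InIdeal A (τ (m · v) - τ (m · u))
    InIdeal-τ-· (suc zero)    _ v-u∈I = v-u∈I
    InIdeal-τ-· (suc (suc m)) _ v-u∈I = InIdeal-τ-⊕ v-u∈I (InIdeal-τ-· (suc m) (s≤s z≤n) v-u∈I)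

    -- For v = x ⊕ y and the idempotent u = e x ⊕ e y,
    -- Δ v = (τ v - τ u) - (τ (ρ v · v) - τ (ρ v · u)).
    Δ∈InIdeal : ∀ {s} → Generated A s → InIdeal A (Δ s)
    Δ∈InIdeal (gen-base b∈A) = g∈InIdeal b∈A
    Δ∈InIdeal (gen-add {x} {y} x∈A y∈A) =
      InIdeal-cong ([x-y]+[y-z]≈x-z (τ v) (τ u) (τ (e v)))
        (InIdeal-+ v-u∈I (InIdeal-cong u-ev (InIdeal-- (InIdeal-τ-· (ρ v) (ρ-pos v) v-u∈I))))
      where
      v = x ⊕ y
      u = e x ⊕ e y
      v-u∈I : InIdeal A (τ v - τ u)
      v-u∈I = InIdeal-τ-⊕ (Δ∈InIdeal x∈A) (Δ∈InIdeal y∈A)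
      u-ev : - (τ (ρ v · v) - τ (ρ v · u)) ≈ τ u - τ (e v)
      u-ev = trans (⁻¹-anti-homo‿- _ _)
        (+-cong (τ-cong (idempotent⇒·-fixed (idempotent-⊕ (e-idem x) (e-idem y)) (ρ v)))
                (-‿cong (τ-cong (ρ-spec v))))

  module _ {p} (p-prime : Prime p) (p×≈0 : ∀ x → p × x ≈ 0#) where
    open Frobenius R p-prime using (x^q≈y^q⇒[x-y]^q≈0)

    Δ^ρ≈0 : ∀ x → (∃ λ j → period x ≡ p ℕ.^ j) → Δ x ^ ρ x ≈ 0#
    Δ^ρ≈0 x (j , n≡p^j) = [x-y]^r≈0 Y*Y≈Y X^ρ≈Y [YX-Y]^n≈0 (period≤ρ x)
      where
      X = τ x
      Y = τ (e x)
      n = period x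
      Y*Y≈Y : Y * Y ≈ Y
      Y*Y≈Y = trans (τ-homo _ _) (τ-cong (e-idem x))
      X^ρ≈Y : X ^ ρ x ≈ Y
      X^ρ≈Y = trans (τ-^ x (ρ-pos x)) (τ-cong (ρ-spec x))
      [YX]^n≈Y^n : (Y * X) ^ n ≈ Y ^ n
      [YX]^n≈Y^n = begin
        (Y * X) ^ n           ≈⟨ ^-distrib-* Y X n ⟩
        Y ^ n * X ^ n         ≈⟨ *-cong (idempotent-^ Y*Y≈Y (1≤period x)) (τ-^ x (1≤period x)) ⟩
        Y * τ (n · x)         ≈⟨ τ-homo _ _ ⟩
        τ (e x ⊕ n · x)       ≈⟨ τ-cong (e⊕period·≡e x) ⟩
        Y                     ≈⟨ idempotent-^ Y*Y≈Y (1≤period x) ⟨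
        Y ^ n                 ∎
      [YX-Y]^n≈0 : (Y * X - Y) ^ n ≈ 0#
      [YX-Y]^n≈0 = ≡.subst (λ q → (Y * X - Y) ^ q ≈ 0#) (≡.sym n≡p^j)
        (x^q≈y^q⇒[x-y]^q≈0 p×≈0 j (≡.subst (λ q → (Y * X) ^ q ≈ Y ^ q) n≡p^j [YX]^n≈Y^n))

    module _ (period≡p^ : ∀ x → ∃ λ j → period x ≡ p ℕ.^ j) where

      ∏Δ≈0 : ∀ {A} → (∀ s → Generated A s) → ∀ T → cost A ≤ length T → ∏ (map Δ T) ≈ 0#
      ∏Δ≈0 {A} generates T long = ∏≈0 ρ (λ x → Δ^ρ≈0 x (period≡p^ x)) A (map Δ T)
        (All.map⁺ (All.universal (λ t → Δ∈InIdeal (generates t)) T))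
        (≡.subst (cost A ≤_) (≡.sym (length-map Δ T)) long)


module AdjoinIdentity (S : FinCommSemigroup) where
  open FinCommSemigroup S

  S¹ : Set
  S¹ = Maybe Carrier

  infixl 6 _⊕¹_
  _⊕¹_ : S¹ → S¹ → S¹
  nothing ⊕¹ y       = y
  just x  ⊕¹ nothing = just x
  just x  ⊕¹ just y  = just (x ⊕ y)

  ⊕¹-assoc : ∀ x y z → (x ⊕¹ y) ⊕¹ z ≡ x ⊕¹ (y ⊕¹ z)
  ⊕¹-assoc nothing  y        z        = ≡.refl
  ⊕¹-assoc (just x) nothing  z        = ≡.refl
  ⊕¹-assoc (just x) (just y) nothing  = ≡.refl
  ⊕¹-assoc (just x) (just y) (just z) = ≡.cong just (assoc x y z)

  ⊕¹-comm : ∀ x y → x ⊕¹ y ≡ y ⊕¹ x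
  ⊕¹-comm nothing  nothing  = ≡.refl
  ⊕¹-comm nothing  (just y) = ≡.refl
  ⊕¹-comm (just x) nothing  = ≡.refl
  ⊕¹-comm (just x) (just y) = ≡.cong just (comm x y)

  ⊕¹-identityʳ : ∀ x → x ⊕¹ nothing ≡ x
  ⊕¹-identityʳ nothing  = ≡.refl
  ⊕¹-identityʳ (just x) = ≡.refl

  ⊕¹-right-comm : ∀ w s t → (w ⊕¹ s) ⊕¹ t ≡ (w ⊕¹ t) ⊕¹ s
  ⊕¹-right-comm w s t =
    ≡.trans (⊕¹-assoc w s t) (≡.trans (≡.cong (w ⊕¹_) (⊕¹-comm s t)) (≡.sym (⊕¹-assoc w t s)))


-- R[X;S] need not have a unit, so the ring-theoretic part of the argument is run in this
-- unital ring instead.  An operator Σ aᵢ [sᵢ] acts on φ : S¹ → K by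
-- (Σ aᵢ [sᵢ]) φ w = Σ aᵢ φ (w ⊕ sᵢ); identifying operators with equal actions yields a
-- commutative ring, a quotient of the monoid ring R[S¹].
module TranslationOperators {c ℓ} (S : FinCommSemigroup) (R : CommutativeRing c ℓ) where
  open import Data.Product using (_×_)
  open FinCommSemigroup S using (Carrier; _⊕_)
  open AdjoinIdentity S
  open CommutativeRing R renaming (Carrier to K)
  open SemigroupRing S R using (natR)
  open import Algebra.Properties.Ring ring using (-‿distribˡ-*; -0#≈0#; -‿+-comm)
  open import Algebra.Properties.CommutativeSemigroup +-commutativeSemigroup using (interchange)
  open import Algebra.Properties.CommutativeSemigroup *-commutativeSemigroup using (x∙yz≈y∙xz)
  open import Relation.Binary.Reasoning.Setoid setoid

  Op : Set c
  Op = List (K × S¹)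

  ⟦_⟧ : Op → (S¹ → K) → S¹ → K
  ⟦ [] ⟧          φ w = 0#
  ⟦ (a , s) ∷ L ⟧ φ w = a * φ (w ⊕¹ s) + ⟦ L ⟧ φ w

  infix 4 _≈ᵒ_
  _≈ᵒ_ : Op → Op → Set (c ⊔ ℓ)
  L ≈ᵒ L′ = ∀ φ w → ⟦ L ⟧ φ w ≈ ⟦ L′ ⟧ φ w

  infixl 6 _+ᵒ_
  infixl 7 _*ᵒ_
  infix  8 -ᵒ_

  _+ᵒ_ : Op → Op → Op
  _+ᵒ_ = _++_

  -ᵒ_ : Op → Op
  -ᵒ_ = map (λ (a , s) → (- a , s))

  _*ᵒ_ : Op → Op → Op
  []            *ᵒ L′ = []
  ((a , s) ∷ L) *ᵒ L′ = map (λ (b , t) → (a * b , s ⊕¹ t)) L′ ++ (L *ᵒ L′)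

  0ᵒ : Op
  0ᵒ = []

  1ᵒ : Op
  1ᵒ = (1# , nothing) ∷ []

  [_] : Carrier → Op
  [ s ] = (1# , just s) ∷ []

  φ-cong : ∀ (φ : S¹ → K) {x y} → x ≡ y → φ x ≈ φ y
  φ-cong φ ≡.refl = refl

  ⟦⟧-cong : ∀ L {φ ψ : S¹ → K} → (∀ w → φ w ≈ ψ w) → ∀ w → ⟦ L ⟧ φ w ≈ ⟦ L ⟧ ψ w
  ⟦⟧-cong []            φ≈ψ w = refl
  ⟦⟧-cong ((a , s) ∷ L) φ≈ψ w = +-cong (*-congˡ (φ≈ψ _)) (⟦⟧-cong L φ≈ψ w)

  ⟦⟧-0 : ∀ L w → ⟦ L ⟧ (λ _ → 0#) w ≈ 0#
  ⟦⟧-0 []            w = refl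
  ⟦⟧-0 ((a , s) ∷ L) w = trans (+-cong (zeroʳ a) (⟦⟧-0 L w)) (+-identityˡ 0#)

  ⟦⟧-+ : ∀ L (φ ψ : S¹ → K) w → ⟦ L ⟧ (λ x → φ x + ψ x) w ≈ ⟦ L ⟧ φ w + ⟦ L ⟧ ψ w
  ⟦⟧-+ []            φ ψ w = sym (+-identityˡ 0#)
  ⟦⟧-+ ((a , s) ∷ L) φ ψ w = trans (+-cong (distribˡ a _ _) (⟦⟧-+ L φ ψ w)) (interchange _ _ _ _)

  ⟦⟧-* : ∀ L b (φ : S¹ → K) w → ⟦ L ⟧ (λ x → b * φ x) w ≈ b * ⟦ L ⟧ φ w
  ⟦⟧-* []            b φ w = sym (zeroʳ b)
  ⟦⟧-* ((a , s) ∷ L) b φ w = trans (+-cong (x∙yz≈y∙xz a b _) (⟦⟧-* L b φ w)) (sym (distribˡ b _ _))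

  ⟦⟧-translate : ∀ L (φ : S¹ → K) s w → ⟦ L ⟧ (λ x → φ (x ⊕¹ s)) w ≈ ⟦ L ⟧ φ (w ⊕¹ s)
  ⟦⟧-translate []            φ s w = refl
  ⟦⟧-translate ((a , t) ∷ L) φ s w = +-cong (*-congˡ (φ-cong φ (⊕¹-right-comm w t s))) (⟦⟧-translate L φ s w)

  ⟦+ᵒ⟧ : ∀ L L′ φ w → ⟦ L +ᵒ L′ ⟧ φ w ≈ ⟦ L ⟧ φ w + ⟦ L′ ⟧ φ w
  ⟦+ᵒ⟧ []            L′ φ w = sym (+-identityˡ _)
  ⟦+ᵒ⟧ ((a , s) ∷ L) L′ φ w = trans (+-congˡ (⟦+ᵒ⟧ L L′ φ w)) (sym (+-assoc _ _ _))

  ⟦-ᵒ⟧ : ∀ L φ w → ⟦ -ᵒ L ⟧ φ w ≈ - ⟦ L ⟧ φ w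
  ⟦-ᵒ⟧ []            φ w = sym -0#≈0#
  ⟦-ᵒ⟧ ((a , s) ∷ L) φ w = trans (+-cong (sym (-‿distribˡ-* a _)) (⟦-ᵒ⟧ L φ w)) (-‿+-comm _ _)

  ⟦*ᵒ⟧ : ∀ L L′ φ w → ⟦ L *ᵒ L′ ⟧ φ w ≈ ⟦ L ⟧ (⟦ L′ ⟧ φ) w
  ⟦*ᵒ⟧ []            L′ φ w = refl
  ⟦*ᵒ⟧ ((a , s) ∷ L) L′ φ w =
    trans (⟦+ᵒ⟧ (map _ L′) (L *ᵒ L′) φ w) (+-cong (scaled L′) (⟦*ᵒ⟧ L L′ φ w))
    where
    scaled : ∀ L′ → ⟦ map (λ (b , t) → (a * b , s ⊕¹ t)) L′ ⟧ φ w ≈ a * ⟦ L′ ⟧ φ (w ⊕¹ s)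
    scaled []             = sym (zeroʳ a)
    scaled ((b , t) ∷ L′) = begin
      a * b * φ (w ⊕¹ (s ⊕¹ t)) + ⟦ map _ L′ ⟧ φ w
        ≈⟨ +-cong (trans (*-assoc a b _) (*-congˡ (*-congˡ (φ-cong φ (≡.sym (⊕¹-assoc w s t)))))) (scaled L′) ⟩
      a * (b * φ (w ⊕¹ s ⊕¹ t)) + a * ⟦ L′ ⟧ φ (w ⊕¹ s)
        ≈⟨ distribˡ a _ _ ⟨
      a * ⟦ (b , t) ∷ L′ ⟧ φ (w ⊕¹ s) ∎

  ⟦1ᵒ⟧ : ∀ (φ : S¹ → K) w → ⟦ 1ᵒ ⟧ φ w ≈ φ w
  ⟦1ᵒ⟧ φ w = trans (+-identityʳ _) (trans (*-identityˡ _) (φ-cong φ (⊕¹-identityʳ w)))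

  ⟦⟧-comm : ∀ L L′ φ w → ⟦ L ⟧ (⟦ L′ ⟧ φ) w ≈ ⟦ L′ ⟧ (⟦ L ⟧ φ) w
  ⟦⟧-comm []            L′ φ w = sym (⟦⟧-0 L′ w)
  ⟦⟧-comm ((a , s) ∷ L) L′ φ w = begin
    a * ⟦ L′ ⟧ φ (w ⊕¹ s) + ⟦ L ⟧ (⟦ L′ ⟧ φ) w
      ≈⟨ +-cong (*-congˡ (sym (⟦⟧-translate L′ φ s w))) (⟦⟧-comm L L′ φ w) ⟩
    a * ⟦ L′ ⟧ (λ x → φ (x ⊕¹ s)) w + ⟦ L′ ⟧ (⟦ L ⟧ φ) w
      ≈⟨ +-congʳ (⟦⟧-* L′ a _ w) ⟨
    ⟦ L′ ⟧ (λ x → a * φ (x ⊕¹ s)) w + ⟦ L′ ⟧ (⟦ L ⟧ φ) w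
      ≈⟨ ⟦⟧-+ L′ _ _ w ⟨
    ⟦ L′ ⟧ (⟦ (a , s) ∷ L ⟧ φ) w ∎

  isCommutativeRingᵒ : IsCommutativeRing _≈ᵒ_ _+ᵒ_ _*ᵒ_ -ᵒ_ 0ᵒ 1ᵒ
  isCommutativeRingᵒ = record
    { isRing = record
      { +-isAbelianGroup = record
        { isGroup = record
          { isMonoid = record
            { isSemigroup = record
              { isMagma = record
                { isEquivalence = record
                  { refl  = λ φ w → refl
                  ; sym   = λ L≈L′ φ w → sym (L≈L′ φ w)
                  ; trans = λ L≈L′ L′≈L″ φ w → trans (L≈L′ φ w) (L′≈L″ φ w) }
                ; ∙-cong = λ {L} {L′} {M} {M′} L≈L′ M≈M′ φ w →
                    ≈-by-⟦⟧ (⟦+ᵒ⟧ L M φ w) (+-cong (L≈L′ φ w) (M≈M′ φ w)) (⟦+ᵒ⟧ L′ M′ φ w) }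
              ; assoc = λ L M N φ w →
                  trans (⟦+ᵒ⟧ (L +ᵒ M) N φ w) (trans (+-congʳ (⟦+ᵒ⟧ L M φ w)) (trans (+-assoc _ _ _)
                    (trans (+-congˡ (sym (⟦+ᵒ⟧ M N φ w))) (sym (⟦+ᵒ⟧ L (M +ᵒ N) φ w))))) }
            ; identity = (λ L φ w → refl) , (λ L φ w → trans (⟦+ᵒ⟧ L [] φ w) (+-identityʳ _)) }
          ; inverse = (λ L φ w → trans (⟦+ᵒ⟧ (-ᵒ L) L φ w) (trans (+-congʳ (⟦-ᵒ⟧ L φ w)) (-‿inverseˡ _)))
                    , (λ L φ w → trans (⟦+ᵒ⟧ L (-ᵒ L) φ w) (trans (+-congˡ (⟦-ᵒ⟧ L φ w)) (-‿inverseʳ _)))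
          ; ⁻¹-cong = λ {L} {L′} L≈L′ φ w → ≈-by-⟦⟧ (⟦-ᵒ⟧ L φ w) (-‿cong (L≈L′ φ w)) (⟦-ᵒ⟧ L′ φ w) }
        ; comm = λ L M φ w → ≈-by-⟦⟧ (⟦+ᵒ⟧ L M φ w) (+-comm _ _) (⟦+ᵒ⟧ M L φ w) }
      ; *-cong = λ {L} {L′} {M} {M′} L≈L′ M≈M′ φ w →
          ≈-by-⟦⟧ (⟦*ᵒ⟧ L M φ w) (trans (⟦⟧-cong L (M≈M′ φ) w) (L≈L′ (⟦ M′ ⟧ φ) w)) (⟦*ᵒ⟧ L′ M′ φ w)
      ; *-assoc = λ L M N φ w →
          trans (⟦*ᵒ⟧ (L *ᵒ M) N φ w) (trans (⟦*ᵒ⟧ L M (⟦ N ⟧ φ) w)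
            (trans (⟦⟧-cong L (λ w′ → sym (⟦*ᵒ⟧ M N φ w′)) w) (sym (⟦*ᵒ⟧ L (M *ᵒ N) φ w))))
      ; *-identity = (λ L φ w → trans (⟦*ᵒ⟧ 1ᵒ L φ w) (⟦1ᵒ⟧ (⟦ L ⟧ φ) w))
                   , (λ L φ w → trans (⟦*ᵒ⟧ L 1ᵒ φ w) (⟦⟧-cong L (⟦1ᵒ⟧ φ) w))
      ; distrib = (λ L M N φ w → ≈-by-⟦⟧ (trans (⟦*ᵒ⟧ L (M +ᵒ N) φ w) (⟦⟧-cong L (⟦+ᵒ⟧ M N φ) w))
                    (⟦⟧-+ L _ _ w) (trans (⟦+ᵒ⟧ (L *ᵒ M) (L *ᵒ N) φ w) (+-cong (⟦*ᵒ⟧ L M φ w) (⟦*ᵒ⟧ L N φ w))))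
                , (λ L M N φ w → ≈-by-⟦⟧ (trans (⟦*ᵒ⟧ (M +ᵒ N) L φ w) (⟦+ᵒ⟧ M N (⟦ L ⟧ φ) w))
                    refl (trans (⟦+ᵒ⟧ (M *ᵒ L) (N *ᵒ L) φ w) (+-cong (⟦*ᵒ⟧ M L φ w) (⟦*ᵒ⟧ N L φ w)))) }
    ; *-comm = λ L M φ w → ≈-by-⟦⟧ (⟦*ᵒ⟧ L M φ w) (⟦⟧-comm L M φ w) (⟦*ᵒ⟧ M L φ w) }
    where
    ≈-by-⟦⟧ : ∀ {x x′ y y′} → x ≈ x′ → x′ ≈ y′ → y ≈ y′ → x ≈ y
    ≈-by-⟦⟧ x≈x′ x′≈y′ y≈y′ = trans x≈x′ (trans x′≈y′ (sym y≈y′))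

  operatorRing : CommutativeRing c (c ⊔ ℓ)
  operatorRing = record { isCommutativeRing = isCommutativeRingᵒ }

  open import Algebra.Properties.Semiring.Mult (CommutativeRing.semiring operatorRing) using () renaming (_×_ to _×ᵒ_)

  []-homo : ∀ s t → [ s ] *ᵒ [ t ] ≈ᵒ [ s ⊕ t ]
  []-homo s t φ w = +-congʳ (*-congʳ (*-identityˡ 1#))

  ⟦[]⟧ : ∀ s φ w → ⟦ [ s ] ⟧ φ w ≈ φ (w ⊕¹ just s)
  ⟦[]⟧ s φ w = trans (+-identityʳ _) (*-identityˡ _)

  ⟦×⟧ : ∀ n L φ w → ⟦ n ×ᵒ L ⟧ φ w ≈ natR n * ⟦ L ⟧ φ w
  ⟦×⟧ zero    L φ w = sym (zeroˡ _)
  ⟦×⟧ (suc n) L φ w = begin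
    ⟦ L +ᵒ n ×ᵒ L ⟧ φ w                  ≈⟨ ⟦+ᵒ⟧ L (n ×ᵒ L) φ w ⟩
    ⟦ L ⟧ φ w + ⟦ n ×ᵒ L ⟧ φ w           ≈⟨ +-cong (sym (*-identityˡ _)) (⟦×⟧ n L φ w) ⟩
    1# * ⟦ L ⟧ φ w + natR n * ⟦ L ⟧ φ w ≈⟨ distribʳ _ 1# (natR n) ⟨
    natR (suc n) * ⟦ L ⟧ φ w            ∎

  ×≈0ᵒ : ∀ {n} → natR n ≈ 0# → ∀ L → n ×ᵒ L ≈ᵒ 0ᵒ
  ×≈0ᵒ {n} n≈0 L φ w = trans (⟦×⟧ n L φ w) (trans (*-congʳ n≈0) (zeroˡ _))


module ListSums {c ℓ} (R : CommutativeRing c ℓ) where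
  open CommutativeRing R renaming (Carrier to K)
  open import Algebra.Properties.Ring ring using (-0#≈0#; -‿+-comm)
  open import Algebra.Properties.CommutativeSemigroup +-commutativeSemigroup using (interchange)

  sumOver : {A : Set} → List A → (A → K) → K
  sumOver L h = foldr (λ s r → h s + r) 0# L

  module _ {A : Set} where

    sumOver-cong : ∀ (L : List A) {h h′ : A → K} → (∀ s → h s ≈ h′ s) → sumOver L h ≈ sumOver L h′
    sumOver-cong []      h≈h′ = refl
    sumOver-cong (x ∷ L) h≈h′ = +-cong (h≈h′ x) (sumOver-cong L h≈h′)

    sumOver-0 : ∀ (L : List A) {h : A → K} → All (λ s → h s ≈ 0#) L → sumOver L h ≈ 0#
    sumOver-0 []      []              = refl
    sumOver-0 (x ∷ L) (hx≈0 ∷ hL≈0) = trans (+-cong hx≈0 (sumOver-0 L hL≈0)) (+-identityˡ 0#)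

    sumOver-+ : ∀ (L : List A) (h h′ : A → K) → sumOver L (λ s → h s + h′ s) ≈ sumOver L h + sumOver L h′
    sumOver-+ []      h h′ = sym (+-identityˡ 0#)
    sumOver-+ (x ∷ L) h h′ = trans (+-congˡ (sumOver-+ L h h′)) (interchange _ _ _ _)

    sumOver-- : ∀ (L : List A) (h h′ : A → K) → sumOver L (λ s → h s - h′ s) ≈ sumOver L h - sumOver L h′
    sumOver-- L h h′ = trans (sumOver-+ L h (λ s → - h′ s)) (+-congˡ (negated L))
      where
      negated : ∀ L → sumOver L (λ s → - h′ s) ≈ - sumOver L h′
      negated []      = sym -0#≈0#
      negated (x ∷ L) = trans (+-congˡ (negated L)) (-‿+-comm _ _)

    sumOver-* : ∀ (L : List A) a (h : A → K) → sumOver L (λ s → a * h s) ≈ a * sumOver L h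
    sumOver-* []      a h = sym (zeroʳ a)
    sumOver-* (x ∷ L) a h = trans (+-congˡ (sumOver-* L a h)) (sym (distribˡ a _ _))

    sumOver-δ : ∀ {L : List A} {w} (h : A → K) → Unique L → w ∈ L → (∀ s → s ≢ w → h s ≈ 0#) →
                sumOver L h ≈ h w
    sumOver-δ {x ∷ L} h (x∉L AllPairs.∷ _) (here ≡.refl) h≈0 =
      trans (+-congˡ (sumOver-0 L (All.map (λ x≢s → h≈0 _ (x≢s ∘ ≡.sym)) x∉L))) (+-identityʳ _)
    sumOver-δ {x ∷ L} h (x∉L AllPairs.∷ L-unique) (there w∈L) h≈0 =
      trans (+-cong (h≈0 x (λ x≡w → All.lookup x∉L w∈L x≡w)) (sumOver-δ h L-unique w∈L h≈0)) (+-identityˡ _)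

  sumOver-swap : ∀ {A B : Set} (L : List A) (M : List B) (h : A → B → K) →
                 sumOver L (λ s → sumOver M (h s)) ≈ sumOver M (λ t → sumOver L (λ s → h s t))
  sumOver-swap []      M h = sym (sumOver-0 M (All.universal (λ _ → refl) M))
  sumOver-swap (x ∷ L) M h = trans (+-congˡ (sumOver-swap L M h)) (sym (sumOver-+ M (h x) _))


module SemigroupRingTranslation {c ℓ} (S : FinCommSemigroup) (R : CommutativeRing c ℓ) where
  open FinCommSemigroup S
  open AdjoinIdentity S
  open CommutativeRing R renaming (Carrier to K)
  open SemigroupRing S R
  open ListSums R
  open import Algebra.Properties.Ring ring using (x[y-z]≈xy-xz; [y-z]x≈yx-zx)
  open import Relation.Binary.Reasoning.Setoid setoid

  X^-self : ∀ w → X^ w w ≈ 1#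
  X^-self w with w ≟ w
  ... | yes _   = refl
  ... | no  w≢w = contradiction ≡.refl w≢w

  X^-other : ∀ {w s} → s ≢ w → X^ w s ≈ 0#
  X^-other {w} {s} s≢w with w ≟ s
  ... | yes w≡s = contradiction (≡.sym w≡s) s≢w
  ... | no  _   = refl

  X^-cong : ∀ {s t} u → s ≡ t → X^ s u ≈ X^ t u
  X^-cong u ≡.refl = refl

  Σ-elems-δ : ∀ w (h : Carrier → K) → (∀ s → s ≢ w → h s ≈ 0#) → Σ-elems h ≈ h w
  Σ-elems-δ w h = sumOver-δ h elems-unique (elems-complete w)

  -- The left-hand side is the summand of _⊠_, local to Defs; unification supplies it.
  ⊠-coefficient : ∀ f g u s t → _ ≈ X^ (s ⊕ t) u * (f s * g t)

  ⊠-spec : ∀ f g u → (f ⊠ g) u ≈ Σ-elems (λ s → Σ-elems (λ t → X^ (s ⊕ t) u * (f s * g t)))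
  ⊠-spec f g u = sumOver-cong elements (λ s → sumOver-cong elements (⊠-coefficient f g u s))

  ⊠-coefficient f g u s t with (s ⊕ t) ≟ u
  ... | yes _ = sym (*-identityˡ _)
  ... | no  _ = sym (zeroˡ _)

  ⊠-cong : ∀ {f f′ g g′} → (∀ u → f u ≈ f′ u) → (∀ u → g u ≈ g′ u) → ∀ u → (f ⊠ g) u ≈ (f′ ⊠ g′) u
  ⊠-cong {f} {f′} {g} {g′} f≈f′ g≈g′ u = begin
    (f ⊠ g) u                                                     ≈⟨ ⊠-spec f g u ⟩
    Σ-elems (λ s → Σ-elems (λ t → X^ (s ⊕ t) u * (f s * g t)))
      ≈⟨ sumOver-cong elements (λ s → sumOver-cong elements (λ t → *-congˡ (*-cong (f≈f′ s) (g≈g′ t)))) ⟩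
    Σ-elems (λ s → Σ-elems (λ t → X^ (s ⊕ t) u * (f′ s * g′ t))) ≈⟨ ⊠-spec f′ g′ u ⟨
    (f′ ⊠ g′) u                                                   ∎

  χ : Carrier → S¹ → K
  χ u nothing  = 0#
  χ u (just s) = X^ s u

  translate : S¹ → RS → RS
  translate nothing  g   = g
  translate (just w) g u = Σ-elems (λ t → X^ (w ⊕ t) u * g t)

  X^-⊠ : ∀ w g u → (X^ w ⊠ g) u ≈ translate (just w) g u
  X^-⊠ w g u = begin
    (X^ w ⊠ g) u
      ≈⟨ ⊠-spec (X^ w) g u ⟩
    Σ-elems (λ s → Σ-elems (λ t → X^ (s ⊕ t) u * (X^ w s * g t)))
      ≈⟨ Σ-elems-δ w _ (λ s s≢w → sumOver-0 elements (All.universal (λ t → killed s≢w) elements)) ⟩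
    Σ-elems (λ t → X^ (w ⊕ t) u * (X^ w w * g t))
      ≈⟨ sumOver-cong elements (λ t → *-congˡ (trans (*-congʳ (X^-self w)) (*-identityˡ _))) ⟩
    translate (just w) g u ∎
    where
    killed : ∀ {s t} → s ≢ w → X^ (s ⊕ t) u * (X^ w s * g t) ≈ 0#
    killed s≢w = trans (*-congˡ (trans (*-congʳ (X^-other s≢w)) (zeroˡ _))) (zeroʳ _)

  ⊟-⊠ : ∀ f f′ g u → ((f ⊟ f′) ⊠ g) u ≈ (f ⊠ g) u - (f′ ⊠ g) u
  ⊟-⊠ f f′ g u = begin
    ((f ⊟ f′) ⊠ g) u
      ≈⟨ ⊠-spec (f ⊟ f′) g u ⟩
    Σ-elems (λ s → Σ-elems (λ t → X^ (s ⊕ t) u * ((f s - f′ s) * g t)))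
      ≈⟨ sumOver-cong elements (λ s → sumOver-cong elements (λ t →
           trans (*-congˡ ([y-z]x≈yx-zx (g t) (f s) (f′ s))) (x[y-z]≈xy-xz _ _ _))) ⟩
    Σ-elems (λ s → Σ-elems (λ t → X^ (s ⊕ t) u * (f s * g t) - X^ (s ⊕ t) u * (f′ s * g t)))
      ≈⟨ sumOver-cong elements (λ s → sumOver-- elements _ _) ⟩
    Σ-elems (λ s → Σ-elems (λ t → X^ (s ⊕ t) u * (f s * g t)) - Σ-elems (λ t → X^ (s ⊕ t) u * (f′ s * g t)))
      ≈⟨ sumOver-- elements _ _ ⟩
    Σ-elems (λ s → Σ-elems (λ t → X^ (s ⊕ t) u * (f s * g t)))
      - Σ-elems (λ s → Σ-elems (λ t → X^ (s ⊕ t) u * (f′ s * g t)))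
      ≈⟨ +-cong (⊠-spec f g u) (-‿cong (⊠-spec f′ g u)) ⟨
    (f ⊠ g) u - (f′ ⊠ g) u ∎

  translate-cong : ∀ w {g g′} → (∀ r → g r ≈ g′ r) → ∀ u → translate w g u ≈ translate w g′ u
  translate-cong nothing  g≈g′ u = g≈g′ u
  translate-cong (just w) g≈g′ u = sumOver-cong elements (λ t → *-congˡ (g≈g′ t))

  translate-⊟ : ∀ w g g′ u → translate w (g ⊟ g′) u ≈ translate w g u - translate w g′ u
  translate-⊟ nothing  g g′ u = refl
  translate-⊟ (just w) g g′ u =
    trans (sumOver-cong elements (λ t → x[y-z]≈xy-xz _ _ _)) (sumOver-- elements _ _)

  translate-X^ : ∀ w t u → translate w (X^ t) u ≈ χ u (w ⊕¹ just t)
  translate-X^ nothing  t u = refl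
  translate-X^ (just w) t u = begin
    Σ-elems (λ s → X^ (w ⊕ s) u * X^ t s)
      ≈⟨ Σ-elems-δ t _ (λ s s≢t → trans (*-congˡ (X^-other s≢t)) (zeroʳ _)) ⟩
    X^ (w ⊕ t) u * X^ t t
      ≈⟨ trans (*-congˡ (X^-self t)) (*-identityʳ _) ⟩
    X^ (w ⊕ t) u ∎

  translate-translate : ∀ w t g u → translate w (translate (just t) g) u ≈ translate (w ⊕¹ just t) g u
  translate-translate nothing  t g u = refl
  translate-translate (just w) t g u = begin
    Σ-elems (λ r → X^ (w ⊕ r) u * Σ-elems (λ x → X^ (t ⊕ x) r * g x))
      ≈⟨ sumOver-cong elements (λ r → sym (sumOver-* elements _ _)) ⟩
    Σ-elems (λ r → Σ-elems (λ x → X^ (w ⊕ r) u * (X^ (t ⊕ x) r * g x)))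
      ≈⟨ sumOver-swap elements elements _ ⟩
    Σ-elems (λ x → Σ-elems (λ r → X^ (w ⊕ r) u * (X^ (t ⊕ x) r * g x)))
      ≈⟨ sumOver-cong elements (λ x → Σ-elems-δ (t ⊕ x) _ (λ r r≢t⊕x →
           trans (*-congˡ (trans (*-congʳ (X^-other r≢t⊕x)) (zeroˡ _))) (zeroʳ _))) ⟩
    Σ-elems (λ x → X^ (w ⊕ (t ⊕ x)) u * (X^ (t ⊕ x) (t ⊕ x) * g x))
      ≈⟨ sumOver-cong elements (λ x →
           *-cong (X^-cong u (≡.sym (assoc w t x))) (trans (*-congʳ (X^-self _)) (*-identityˡ _))) ⟩
    Σ-elems (λ x → X^ (w ⊕ t ⊕ x) u * g x) ∎


module IteratedDifferences {c ℓ} (S : FinCommSemigroup) (D : SemigroupNotions.CyclicData S)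
                           (R : CommutativeRing c ℓ) where
  open import Data.Product using (_×_)
  open FinCommSemigroup S
  open SemigroupNotions S
  open CyclicData D
  open WithData D
  open AdjoinIdentity S
  open CommutativeRing R renaming (Carrier to K)
  open SemigroupRing S R
  open SemigroupRingTranslation S R
  open TranslationOperators S R
  open import Algebra.Properties.Ring ring using (-‿involutive)
  open CyclicSubsemigroups S D using (⊕-commutativeSemigroup)
  open import Algebra.Properties.CommutativeSemigroup ⊕-commutativeSemigroup using (xy∙z≈xz∙y)
  open import Relation.Binary.Reasoning.Setoid setoid

  -- Φ φ w T = Σ_{U ⊆ T} ± φ (w + ΣU + Σ_{t ∈ T∖U} e t): the product ∏_{t ∈ T} (X^t − X^(e t)),
  -- translated by w and tested against φ.
  Φ : (S¹ → K) → S¹ → List Carrier → K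
  Φ φ w []      = φ w
  Φ φ w (t ∷ T) = Φ φ (w ⊕¹ just t) T - Φ φ (w ⊕¹ just (e t)) T

  Φ-cong : ∀ φ T {w w′} → w ≡ w′ → Φ φ w T ≈ Φ φ w′ T
  Φ-cong φ T ≡.refl = refl

  ∏X^-X^e : List Carrier → RS
  ∏X^-X^e T = prodRS (map (λ s → X^ s ⊟ X^ (e s)) T)

  translate-∏X^-X^e : ∀ t T w u → translate w (∏X^-X^e (t ∷ T)) u ≈ Φ (χ u) w (t ∷ T)
  translate-∏X^-X^e t [] w u =
    trans (translate-⊟ w (X^ t) (X^ (e t)) u) (+-cong (translate-X^ w t u) (-‿cong (translate-X^ w (e t) u)))
  translate-∏X^-X^e t (t′ ∷ T) w u = begin
    translate w (∏X^-X^e (t ∷ t′ ∷ T)) u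
      ≈⟨ translate-cong w factor u ⟩
    translate w (translate (just t) G ⊟ translate (just (e t)) G) u
      ≈⟨ translate-⊟ w _ _ u ⟩
    translate w (translate (just t) G) u - translate w (translate (just (e t)) G) u
      ≈⟨ +-cong (translate-translate w t G u) (-‿cong (translate-translate w (e t) G u)) ⟩
    translate (w ⊕¹ just t) G u - translate (w ⊕¹ just (e t)) G u
      ≈⟨ +-cong (translate-∏X^-X^e t′ T _ u) (-‿cong (translate-∏X^-X^e t′ T _ u)) ⟩
    Φ (χ u) w (t ∷ t′ ∷ T) ∎
    where
    G = ∏X^-X^e (t′ ∷ T)
    factor : ∀ r → ∏X^-X^e (t ∷ t′ ∷ T) r ≈ translate (just t) G r - translate (just (e t)) G r
    factor r = trans (⊟-⊠ (X^ t) (X^ (e t)) G r) (+-cong (X^-⊠ t G r) (-‿cong (X^-⊠ (e t) G r)))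

  Δᵒ : Carrier → Op
  Δᵒ s = [ s ] +ᵒ -ᵒ [ e s ]

  ⟦∏Δᵒ⟧≈Φ : ∀ T φ w → ⟦ foldr _*ᵒ_ 1ᵒ (map Δᵒ T) ⟧ φ w ≈ Φ φ w T
  ⟦∏Δᵒ⟧≈Φ []      φ w = ⟦1ᵒ⟧ φ w
  ⟦∏Δᵒ⟧≈Φ (t ∷ T) φ w = begin
    ⟦ Δᵒ t *ᵒ P ⟧ φ w                        ≈⟨ ⟦*ᵒ⟧ (Δᵒ t) P φ w ⟩
    ⟦ [ t ] +ᵒ -ᵒ [ e t ] ⟧ ψ w              ≈⟨ ⟦+ᵒ⟧ [ t ] (-ᵒ [ e t ]) ψ w ⟩
    ⟦ [ t ] ⟧ ψ w + ⟦ -ᵒ [ e t ] ⟧ ψ w       ≈⟨ +-cong (⟦[]⟧ t ψ w) (⟦-ᵒ⟧ [ e t ] ψ w) ⟩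
    ψ (w ⊕¹ just t) - ⟦ [ e t ] ⟧ ψ w
      ≈⟨ +-cong (⟦∏Δᵒ⟧≈Φ T φ _) (-‿cong (trans (⟦[]⟧ (e t) ψ w) (⟦∏Δᵒ⟧≈Φ T φ _))) ⟩
    Φ φ w (t ∷ T)                            ∎
    where
    P = foldr _*ᵒ_ 1ᵒ (map Δᵒ T)
    ψ = ⟦ P ⟧ φ

  Absorbs : Carrier → Carrier → Set
  Absorbs w s = w ⊕ e s ≡ w

  absorbs-⊕ : ∀ {w s} c → Absorbs w s → Absorbs (w ⊕ c) s
  absorbs-⊕ {w} {s} c w⊕es≡w = ≡.trans (xy∙z≈xz∙y w c (e s)) (≡.cong (_⊕ c) w⊕es≡w)

  sumS-∷ : ∀ t U → sumS (t ∷ U) ≡ just t ⊕¹ sumS U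
  sumS-∷ t U with sumS U
  ... | nothing = ≡.refl
  ... | just _  = ≡.refl

  Φ-support : ∀ v T w → All (Absorbs w) T →
              Φ (χ v) (just w) T ≈ 0# ⊎ ∃ λ U → U ⊆ T × just v ≡ just w ⊕¹ sumS U
  Φ-support v [] w [] with w ≟ v
  ... | yes w≡v = inj₂ ([] , [] , ≡.cong just (≡.sym w≡v))
  ... | no  _   = inj₁ refl
  Φ-support v (t ∷ T) w (w⊕et≡w ∷ absorbs)
    with Φ-support v T (w ⊕ t) (All.map (absorbs-⊕ t) absorbs) | Φ-support v T w absorbs
  ... | inj₂ (U , U⊆T , v≡) | _ =
    inj₂ (t ∷ U , ≡.refl ∷ U⊆T ,
          ≡.trans v≡ (≡.trans (⊕¹-assoc (just w) (just t) (sumS U)) (≡.cong (just w ⊕¹_) (≡.sym (sumS-∷ t U)))))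
  ... | inj₁ _ | inj₂ (U , U⊆T , v≡) = inj₂ (U , t ∷ʳ U⊆T , v≡)
  ... | inj₁ Φ≈0 | inj₁ Φ′≈0 = inj₁ (begin
    Φ (χ v) (just (w ⊕ t)) T - Φ (χ v) (just (w ⊕ e t)) T
      ≈⟨ +-cong Φ≈0 (-‿cong (trans (Φ-cong (χ v) T (≡.cong just w⊕et≡w)) Φ′≈0)) ⟩
    0# - 0#
      ≈⟨ -‿inverseʳ 0# ⟩
    0# ∎)

  stabilising-sum : ∀ {u} t U → just u ≡ just (u ⊕ t) ⊕¹ sumS U → ∃ λ c → InSt u c × sumS (t ∷ U) ≡ just c
  stabilising-sum {u} t U u≡ with sumS U
  ... | nothing = t , ≡.trans (comm t u) (≡.sym (just-injective u≡)) , ≡.refl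
  ... | just y  = t ⊕ y , ≡.trans (comm _ u) (≡.trans (≡.sym (assoc u t y)) (≡.sym (just-injective u≡))) , ≡.refl

  IsSign : K → Set ℓ
  IsSign x = x ≈ 1# ⊎ x ≈ - 1#

  -- When u absorbs every e t, Φ (χ u) (just u) T = Σ_{U ⊆ T} ± [u + ΣU = u]; the term U = []
  -- is ±1, so either the sum is ±1 or some nonempty U has ΣU ∈ St(u).
  sign-stabiliser : ∀ u T → All (Absorbs u) T →
                    IsSign (Φ (χ u) (just u) T) ⊎ ∃ λ c → InSt u c × InΣ T c
  sign-stabiliser u []      [] = inj₁ (inj₁ (X^-self u))
  sign-stabiliser u (t ∷ T) (u⊕et≡u ∷ absorbs) with Φ-support u T (u ⊕ t) (All.map (absorbs-⊕ t) absorbs)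
  ... | inj₂ (U , U⊆T , u≡) with stabilising-sum t U u≡
  ...   | c , st , ΣU≡c = inj₂ (c , st , t ∷ U , ≡.refl ∷ U⊆T , ΣU≡c)
  sign-stabiliser u (t ∷ T) (u⊕et≡u ∷ absorbs) | inj₁ Φ≈0 with sign-stabiliser u T absorbs
  ... | inj₂ (c , st , U , U⊆T , ΣU≡c) = inj₂ (c , st , U , t ∷ʳ U⊆T , ΣU≡c)
  ... | inj₁ sign = inj₁ (flip sign)
    where
    Φ≈-Φ : Φ (χ u) (just u) (t ∷ T) ≈ - Φ (χ u) (just u) T
    Φ≈-Φ = trans (+-cong Φ≈0 (-‿cong (Φ-cong (χ u) T (≡.cong just u⊕et≡u)))) (+-identityˡ _)
    flip : IsSign (Φ (χ u) (just u) T) → IsSign (Φ (χ u) (just u) (t ∷ T))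
    flip (inj₁ Φ≈1)  = inj₂ (trans Φ≈-Φ (-‿cong Φ≈1))
    flip (inj₂ Φ≈-1) = inj₁ (trans Φ≈-Φ (trans (-‿cong Φ≈-1) (-‿involutive 1#)))

  Σe-absorbs : ∀ t T → ∃ λ f → sumS (map e (t ∷ T)) ≡ just f × All (Absorbs f) (t ∷ T)
  Σe-absorbs t []       = e t , ≡.refl , e-idem t ∷ []
  Σe-absorbs t (t′ ∷ T) with Σe-absorbs t′ T
  ... | f , Σ≡f , absorbs = e t ⊕ f , Σ≡ , absorbs-self ∷ All.map absorbs-left absorbs
    where
    Σ≡ : sumS (map e (t ∷ t′ ∷ T)) ≡ just (e t ⊕ f)
    Σ≡ = ≡.trans (sumS-∷ (e t) (map e (t′ ∷ T))) (≡.cong (just (e t) ⊕¹_) Σ≡f)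
    absorbs-self : Absorbs (e t ⊕ f) t
    absorbs-self = ≡.trans (xy∙z≈xz∙y (e t) f (e t)) (≡.cong (_⊕ f) (e-idem t))
    absorbs-left : ∀ {s} → Absorbs f s → Absorbs (e t ⊕ f) s
    absorbs-left f⊕es≡f = ≡.trans (assoc (e t) f _) (≡.cong (e t ⊕_) f⊕es≡f)


module SemigroupRingOfPrimePowerExponent
         {c ℓ} {p : ℕ} (p-prime : Prime p) (S : FinCommSemigroup) (D : SemigroupNotions.CyclicData S)
         (R : CommutativeRing c ℓ) where
  open import Data.Nat using (_^_)
  open import Data.Product using (_×_)
  open import Data.List.Properties using (length-replicate)
  open FinCommSemigroup S
  open SemigroupNotions S
  open CyclicData D
  open WithData D
  open CyclicSubsemigroups S D
  open CommutativeRing R renaming (Carrier to K)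
  open SemigroupRing S R
  open SemigroupRingTranslation S R
  open TranslationOperators S R
  open IteratedDifferences S D R
  open import Algebra.Properties.Ring ring using (-‿involutive; -0#≈0#)

  characteristic⇒1≉0 : HasCharacteristic p → ¬ 1# ≈ 0#
  characteristic⇒1≉0 (_ , p-least) 1≈0 = p-least 1 (s≤s z≤n) (prime⇒≥2 p-prime) (trans (+-identityʳ 1#) 1≈0)

  sign≉0 : ¬ 1# ≈ 0# → ∀ {x} → IsSign x → ¬ x ≈ 0#
  sign≉0 1≉0 (inj₁ x≈1)  x≈0 = 1≉0 (trans (sym x≈1) x≈0)
  sign≉0 1≉0 (inj₂ x≈-1) x≈0 =
    1≉0 (trans (sym (-‿involutive 1#)) (trans (-‿cong (trans (sym x≈-1) x≈0)) -0#≈0#))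

  zipWith-1≈∏X^-X^e : ∀ T u →
    prodRS (zipWith (λ s a → X^ s ⊟ (a ⊛ X^ (e s))) T (replicate (length T) 1#)) u ≈ ∏X^-X^e T u
  zipWith-1≈∏X^-X^e []           u = refl
  zipWith-1≈∏X^-X^e (t ∷ [])     u = +-congˡ (-‿cong (*-identityˡ _))
  zipWith-1≈∏X^-X^e (t ∷ t′ ∷ T) u =
    ⊠-cong (λ v → +-congˡ (-‿cong (*-identityˡ _))) (zipWith-1≈∏X^-X^e (t′ ∷ T)) u

  module WithGeneratingSet (expS≡p^ : ∃ λ r → expS ≡ p ^ r) (char : HasCharacteristic p)
           {A : List Carrier} (generates : ∀ s → Generated A s) where
    open Differences S D operatorRing [_] []-homo using (∏Δ≈0)

    1≉0 : ¬ 1# ≈ 0#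
    1≉0 = characteristic⇒1≉0 char

    period≡p^ : ∀ x → ∃ λ j → period x ≡ p ^ j
    period≡p^ x = ∣p^r⇒≡p^j p-prime (proj₁ expS≡p^) (≡.subst (period x ∣_) (proj₂ expS≡p^) (period∣expS x))

    Φ≈0 : ∀ T → cost A ≤ length T → ∀ φ w → Φ φ w T ≈ 0#
    Φ≈0 T long φ w =
      trans (sym (⟦∏Δᵒ⟧≈Φ T φ w)) (∏Δ≈0 p-prime (×≈0ᵒ {p} (proj₁ char)) period≡p^ generates T long φ w)

    ∏X^-X^e≈0 : ∀ T → cost A ≤ length T → IsZero (∏X^-X^e T)
    ∏X^-X^e≈0 (t ∷ T) long u = trans (translate-∏X^-X^e t T nothing u) (Φ≈0 (t ∷ T) long (χ u) nothing)

    St∩Σ≢∅ : ∀ T → cost A ≤ length T →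
             Σ Carrier λ f → sumS (map e T) ≡ just f × (Σ Carrier λ c′ → InSt f c′ × InΣ T c′)
    St∩Σ≢∅ (t ∷ T) long with Σe-absorbs t T
    ... | f , Σe≡f , absorbs with sign-stabiliser f (t ∷ T) absorbs
    ...   | inj₂ stabilised = f , Σe≡f , stabilised
    ...   | inj₁ sign       = contradiction (Φ≈0 (t ∷ T) long (χ f) (just f)) (sign≉0 1≉0 sign)

    length≤cost-1 : ∀ T →
      ((as : List K) → length as ≡ length T → All (λ a → ¬ (a ≈ 0#)) as →
        ¬ IsZero (prodRS (zipWith (λ s a → X^ s ⊟ (a ⊛ X^ (e s))) T as))) →
      length T ≤ cost A ∸ 1
    length≤cost-1 T nonvanishing with length T ℕₚ.≤? cost A ∸ 1
    ... | yes short = short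
    ... | no  long  = contradiction
      (λ u → trans (zipWith-1≈∏X^-X^e T u) (∏X^-X^e≈0 T (ℕₚ.≰⇒> long) u))
      (nonvanishing (replicate (length T) 1#) (length-replicate (length T)) (All.replicate⁺ (length T) 1≉0))

-- Imported only here: in the modules above, _^_ and _×_ are powers and multiples in a ring.
open import Data.Nat using (_^_)
open import Data.Product using (_×_)

theorem4p1 : {c ℓ : Level} (p : ℕ) → Prime p →
  (S : FinCommSemigroup) (D : SemigroupNotions.CyclicData S) →
  let open FinCommSemigroup S
      open SemigroupNotions S
      open WithData D
      open CyclicData D
  in (Σ ℕ λ r → expS ≡ p ^ r) →
  (R : CommutativeRing c ℓ) →
  let open CommutativeRing R renaming (Carrier to K)
      open SemigroupRing S R
  in HasCharacteristic p →
  (Λ : ℕ) → IsLambda Λ →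
  -- (i)
  ((T : List Carrier) → Λ ≤ length T →
    IsZero (prodRS (map (λ s → X^ s ⊟ X^ (e s)) T))
    × (Σ Carrier λ f → sumS (map e T) ≡ just f × (Σ Carrier λ c′ → InSt f c′ × InΣ T c′)))
  ×
  -- (ii)  d(S,R) ≤ Λ(S) - 1
  ((T : List Carrier) →
    ((as : List K) → length as ≡ length T → All (λ a → ¬ (a ≈ 0#)) as →
      ¬ IsZero (prodRS (zipWith (λ s a → X^ s ⊟ (a ⊛ X^ (e s))) T as))) →
    length T ≤ Λ ∸ 1)
theorem4p1 p p-prime S D expS≡p^ R char Λ ((A , (_ , generates) , cost≡Λ) , _) =
  (λ T Λ≤|T| → ∏X^-X^e≈0 T (long T Λ≤|T|) , St∩Σ≢∅ T (long T Λ≤|T|)) ,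
  (λ T nonvanishing → ≡.subst (λ L → length T ≤ L ∸ 1) cost≡Λ (length≤cost-1 T nonvanishing))
  where
  open SemigroupRingOfPrimePowerExponent p-prime S D R
  open WithGeneratingSet expS≡p^ char generates
  open SemigroupNotions.WithData S D using (cost)
  long : ∀ T → Λ ≤ length T → cost A ≤ length T
  long T = ≡.subst (_≤ length T) (≡.sym cost≡Λ)
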